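{- Let $p\ge2$. For $n\ge 0$ let $c_n$ be the number of covering pairs in $\mathbb{F}_n^p$, i.e. pairs $(P,Q)$ of elements with $Q$ covering $P$. Then $$\sum_{n\ge0}c_nx^n=\frac{(1-x)(x^2-x^{p+1})(1-x^p)}{(1-2x+x^{p+1})^2}.$$
   Context: A Dyck path of semilength $n\ge 0$ is a lattice path from $(0,0)$ to $(2n,0)$ with steps $U=(1,1)$ and $D=(1,-1)$ that never goes below the $x$-axis; it is identified with its word over $\{U,D\}$. A path avoids a pattern $\alpha$ if $\alpha$ does not occur as a factor (block of consecutive steps). For an integer $p\ge 2$, $\mathcal{F}_n^p$ is the set of Dyck paths of semilength $n$ avoiding $DUU$ and $D^{p+1}$, ordered by the Stanley order: $P\le Q$ iff $P$ lies weakly below $Q$ when both are drawn in the plane; $\mathbb{F}_n^p=(\mathcal{F}_n^p,\le)$. $Q$ covers $P$ if $P<Q$ and no element lies strictly between them. -}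

module Defs where

open import Data.Bool using (Bool; true; false; _∧_; _∨_; not; if_then_else_)
open import Data.Nat as ℕ using (ℕ; zero; suc; _∸_)
open import Data.Integer as ℤ using (ℤ; +_; -_; _+_; _*_; _≤ᵇ_)
open import Data.List using (List; []; _∷_; length; filter; map; concatMap; replicate; zipWith; upTo; foldr)
open import Data.Bool.ListAction using (and; any; all)
open import Relation.Nullary.Decidable using (⌊_⌋)
open import Relation.Binary.PropositionalEquality using (_≡_)

data Step : Set where
  U D : Step

Word : Set
Word = List Step

sumℤ : List ℤ → ℤ
sumℤ = foldr _+_ (+ 0)

_==ˢ_ : Step → Step → Bool
U ==ˢ U = true
D ==ˢ D = true
_ ==ˢ _ = false

_==ʷ_ : Word → Word → Bool
[] ==ʷ [] = true
(a ∷ w) ==ʷ (b ∷ v) = (a ==ˢ b) ∧ (w ==ʷ v)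
_ ==ʷ _ = false

words : ℕ → List Word
words zero = [] ∷ []
words (suc m) = concatMap (λ w → (U ∷ w) ∷ (D ∷ w) ∷ []) (words m)

stepVal : Step → ℤ
stepVal U = + 1
stepVal D = - (+ 1)

heightsFrom : ℤ → Word → List ℤ
heightsFrom h [] = []
heightsFrom h (s ∷ w) = (h + stepVal s) ∷ heightsFrom (h + stepVal s) w

heights : Word → List ℤ
heights = heightsFrom (+ 0)

finalHeight : Word → ℤ
finalHeight w = sumℤ (map stepVal w)

isDyck : Word → Bool
isDyck w = all (λ h → (+ 0) ≤ᵇ h) (heights w) ∧ ⌊ finalHeight w ℤ.≟ + 0 ⌋

isPrefix : Word → Word → Bool
isPrefix [] _ = true
isPrefix (a ∷ u) [] = false
isPrefix (a ∷ u) (b ∷ w) = (a ==ˢ b) ∧ isPrefix u w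

occurs : Word → Word → Bool
occurs α [] = isPrefix α []
occurs α (b ∷ w) = isPrefix α (b ∷ w) ∨ occurs α w

avoids : Word → Word → Bool
avoids w α = not (occurs α w)

-- membership test for F_n^p (given that w has length 2n)
inF : ℕ → Word → Bool
inF p w = isDyck w ∧ avoids w (D ∷ U ∷ U ∷ []) ∧ avoids w (replicate (suc p) D)

F : ℕ → ℕ → List Word
F p n = filter (λ w → inF p w ≡? true) (words (n ℕ.+ n))
  where
  open import Data.Bool.Properties renaming (_≟_ to _≡?_)

_≤ˢ_ : Word → Word → Bool
P ≤ˢ Q = ⌊ length P ℕ.≟ length Q ⌋ ∧ and (zipWith _≤ᵇ_ (heights P) (heights Q))

_<ˢ_ : Word → Word → Bool
P <ˢ Q = (P ≤ˢ Q) ∧ not (P ==ʷ Q)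

covers : ℕ → ℕ → Word → Word → Bool
covers p n P Q = (P <ˢ Q) ∧ not (any (λ R → (P <ˢ R) ∧ (R <ˢ Q)) (F p n))

coverCount : ℕ → ℕ → ℕ
coverCount p n = length (concatMap (λ P → filter (λ Q → covers p n P Q ≡? true) (F p n)) (F p n))
  where
  open import Data.Bool.Properties renaming (_≟_ to _≡?_)

Series : Set
Series = ℕ → ℤ

_⊛_ : Series → Series → Series
(f ⊛ g) n = sumℤ (map (λ k → f k * g (n ∸ k)) (upTo (suc n)))

_⊕_ : Series → Series → Series
(f ⊕ g) n = f n + g n

mono : ℤ → ℕ → Series
mono c k n = if ⌊ n ℕ.≟ k ⌋ then c else + 0

cSeries : ℕ → Series
cSeries p n = + coverCount p n

den : ℕ → Series
den p = mono (+ 1) 0 ⊕ (mono (- (+ 2)) 1 ⊕ mono (+ 1) (suc p))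

num : ℕ → Series
num p = (mono (+ 1) 0 ⊕ mono (- (+ 1)) 1)
      ⊛ ((mono (+ 1) 2 ⊕ mono (- (+ 1)) (suc p))
      ⊛ (mono (+ 1) 0 ⊕ mono (- (+ 1)) p))

-- A path avoiding D U U has the form U^a D^r₁ U D^r₂ ⋯ U D^rₖ, so F_n^p is in
-- bijection with the compositions (r₁, …, rₖ) of n with parts at most p.  In the
-- Stanley order a cover turns one valley D U into a peak U D: such a flip is
-- always a cover, and below every Q > P in F there is a flip of P that lies in F.
-- The flip between the runs rᵢ and rᵢ₊₁ stays in F iff rᵢ₊₁ < p and (i = 1 or
-- rᵢ ≥ 2).  Removing the first part of a composition gives linear recurrences for
-- the number of such flips; with S = x + ⋯ + x^p they say that
-- ∑ cₙ xⁿ = (1 - x) S (S - x^p) / (1 - S)², and (1 - x)(1 - S) = 1 - 2x + x^{p+1}.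

module Submission where

open import Defs

module Combinatorics where

  open import Data.Bool using (Bool; true; false; _∧_; _∨_; not; if_then_else_; T)
  open import Data.Bool.Properties using (∧-conicalˡ; ∧-conicalʳ; ∧-zeroʳ; ∧-identityʳ; ∧-assoc; ∨-zeroʳ; T-≡) renaming (_≟_ to _≟ᵇ_)
  import Data.Nat as ℕ
  open import Data.Nat using (ℕ; zero; suc; _+_; _*_; _∸_; _≤_; _<_; z≤n; s≤s; _≤ᵇ_; _<ᵇ_; _≡ᵇ_; _≤?_)
  open import Data.Nat.Properties
  open import Data.Nat.Tactic.RingSolver using (solve-∀)
  open import Data.List using (List; []; _∷_; length; filter; map; concatMap; replicate; _++_; zipWith; applyDownFrom)
  open import Data.List.Relation.Unary.All using (All; []; _∷_)
  open import Data.Nat.ListAction using (sum)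
  open import Data.List.Membership.Propositional using (_∈_; find)
  open import Data.List.Membership.Propositional.Properties using (∈-map⁺; ∈-map⁻; ∈-concatMap⁺; ∈-concatMap⁻; ∈-filter⁺; ∈-filter⁻; ∈-applyDownFrom⁻)
  open import Data.List.Relation.Unary.Any using (here; there)
  open import Data.List.Relation.Unary.Any.Properties using (any⁺; any⁻)
  import Data.List.Relation.Unary.Any as Any
  open import Data.Product using (Σ; ∃; _×_; _,_; proj₁; proj₂)
  open import Data.Sum using (_⊎_; inj₁; inj₂)
  open import Data.Empty using (⊥-elim)
  open import Relation.Nullary using (does; yes; no; contradiction)
  open import Function.Bundles using (Equivalence)
  open import Relation.Nullary.Decidable using (⌊_⌋; dec-true; dec-false)
  open import Data.Bool.ListAction using (and; any; all)
  import Data.Integer as ℤ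
  import Data.Integer.Properties as ℤP
  open import Relation.Unary using (Decidable)
  open import Relation.Binary.Definitions using (DecidableEquality)
  open import Data.List.Properties using (≡-dec; length-++; length-replicate)
  open import Relation.Binary.PropositionalEquality
  open import Algebra.Properties.CommutativeSemigroup +-commutativeSemigroup using (interchange) renaming (x∙yz≈y∙xz to +-x∙yz≈y∙xz)
  open import Algebra.Properties.CommutativeSemigroup *-commutativeSemigroup using () renaming (x∙yz≈y∙xz to *-x∙yz≈y∙xz)

  𝟙 : Bool → ℕ
  𝟙 true = 1
  𝟙 false = 0

  ∧-true⁻ : ∀ {a b} → a ∧ b ≡ true → a ≡ true × b ≡ true
  ∧-true⁻ {a} {b} e = ∧-conicalˡ a b e , ∧-conicalʳ a b e

  ∧-true⁺ : ∀ {a b} → a ≡ true → b ≡ true → a ∧ b ≡ true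
  ∧-true⁺ refl refl = refl

  does-≟true : ∀ b → does (b ≟ᵇ true) ≡ b
  does-≟true true = refl
  does-≟true false = refl

  T⇒≡true : ∀ {b} → T b → b ≡ true
  T⇒≡true = Equivalence.to T-≡

  ≡true⇒T : ∀ {b} → b ≡ true → T b
  ≡true⇒T = Equivalence.from T-≡

  ≤ᵇ-true : ∀ {m n} → m ≤ n → (m ≤ᵇ n) ≡ true
  ≤ᵇ-true m≤n = T⇒≡true (≤⇒≤ᵇ m≤n)

  ≤ᵇ-true⁻ : ∀ {m n} → (m ≤ᵇ n) ≡ true → m ≤ n
  ≤ᵇ-true⁻ {m} {n} e = ≤ᵇ⇒≤ m n (≡true⇒T e)

  ≤ᵇ-false : ∀ {m n} → n < m → (m ≤ᵇ n) ≡ false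
  ≤ᵇ-false {m} {n} n<m with m ≤ᵇ n in eq
  ... | false = refl
  ... | true = ⊥-elim (<⇒≱ n<m (≤ᵇ-true⁻ eq))

  <ᵇ-true : ∀ {m n} → m < n → (m <ᵇ n) ≡ true
  <ᵇ-true = ≤ᵇ-true

  <ᵇ-true⁻ : ∀ {m n} → (m <ᵇ n) ≡ true → m < n
  <ᵇ-true⁻ {m} = ≤ᵇ-true⁻ {suc m}

  ≡ᵇ0⁻ : ∀ {m} → (m ≡ᵇ 0) ≡ true → m ≡ 0
  ≡ᵇ0⁻ {zero} _ = refl

  ⌊≟⌋-true⁻ : ∀ {m n} → ⌊ m ℕ.≟ n ⌋ ≡ true → m ≡ n
  ⌊≟⌋-true⁻ {m} {n} e with m ℕ.≟ n
  ... | yes m≡n = m≡n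

  ⌊≟⌋-refl : ∀ m → ⌊ m ℕ.≟ m ⌋ ≡ true
  ⌊≟⌋-refl m rewrite ≡-≟-identity ℕ._≟_ {m} refl = refl

  ∑ : {A : Set} → List A → (A → ℕ) → ℕ
  ∑ [] f = 0
  ∑ (x ∷ xs) f = f x + ∑ xs f

  syntax ∑ xs (λ x → e) = ∑[ x ∈ xs ] e

  private
    variable
      A B : Set

  ∑-++ : (xs ys : List A) (f : A → ℕ) → ∑ (xs ++ ys) f ≡ ∑ xs f + ∑ ys f
  ∑-++ [] ys f = refl
  ∑-++ (x ∷ xs) ys f rewrite ∑-++ xs ys f = sym (+-assoc (f x) _ _)

  ∑-cong : (xs : List A) {f g : A → ℕ} → (∀ x → x ∈ xs → f x ≡ g x) → ∑ xs f ≡ ∑ xs g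
  ∑-cong [] f≡g = refl
  ∑-cong (x ∷ xs) f≡g = cong₂ _+_ (f≡g x (here refl)) (∑-cong xs (λ y y∈xs → f≡g y (there y∈xs)))

  ∑-+ : (xs : List A) (f g : A → ℕ) → ∑[ x ∈ xs ] (f x + g x) ≡ ∑ xs f + ∑ xs g
  ∑-+ [] f g = refl
  ∑-+ (x ∷ xs) f g rewrite ∑-+ xs f g = interchange (f x) (g x) (∑ xs f) (∑ xs g)

  ∑-*ˡ : (xs : List A) (c : ℕ) (f : A → ℕ) → ∑[ x ∈ xs ] (c * f x) ≡ c * ∑ xs f
  ∑-*ˡ [] c f = sym (*-zeroʳ c)
  ∑-*ˡ (x ∷ xs) c f rewrite ∑-*ˡ xs c f = sym (*-distribˡ-+ c (f x) (∑ xs f))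

  ∑-zero : (xs : List A) (f : A → ℕ) → (∀ x → x ∈ xs → f x ≡ 0) → ∑ xs f ≡ 0
  ∑-zero [] f f≡0 = refl
  ∑-zero (x ∷ xs) f f≡0 = cong₂ _+_ (f≡0 x (here refl)) (∑-zero xs f (λ y y∈xs → f≡0 y (there y∈xs)))

  ∑-swap : (xs : List A) (ys : List B) (f : A → B → ℕ) →
    ∑[ x ∈ xs ] ∑[ y ∈ ys ] f x y ≡ ∑[ y ∈ ys ] ∑[ x ∈ xs ] f x y
  ∑-swap [] ys f = sym (∑-zero ys _ (λ _ _ → refl))
  ∑-swap (x ∷ xs) ys f rewrite ∑-swap xs ys f = sym (∑-+ ys (f x) (λ y → ∑[ x′ ∈ xs ] f x′ y))

  ∑-map : (g : B → A) (ys : List B) (f : A → ℕ) → ∑ (map g ys) f ≡ ∑[ y ∈ ys ] f (g y)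
  ∑-map g [] f = refl
  ∑-map g (y ∷ ys) f rewrite ∑-map g ys f = refl

  ∑-concatMap : (g : B → List A) (ys : List B) (f : A → ℕ) →
    ∑ (concatMap g ys) f ≡ ∑[ y ∈ ys ] ∑ (g y) f
  ∑-concatMap g [] f = refl
  ∑-concatMap g (y ∷ ys) f rewrite ∑-++ (g y) (concatMap g ys) f | ∑-concatMap g ys f = refl

  length≡∑1 : (xs : List A) → length xs ≡ ∑[ x ∈ xs ] 1
  length≡∑1 [] = refl
  length≡∑1 (x ∷ xs) = cong suc (length≡∑1 xs)

  ∑-filter : {P : A → Set} (P? : Decidable P) (xs : List A) (f : A → ℕ) →
    ∑ (filter P? xs) f ≡ ∑[ x ∈ xs ] (𝟙 (does (P? x)) * f x)
  ∑-filter P? [] f = refl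
  ∑-filter P? (x ∷ xs) f with does (P? x)
  ... | true = cong₂ _+_ (sym (+-identityʳ (f x))) (∑-filter P? xs f)
  ... | false = ∑-filter P? xs f

  ∑-words-suc : ∀ m (f : Word → ℕ) → ∑ (words (suc m)) f ≡ ∑[ w ∈ words m ] (f (U ∷ w) + (f (D ∷ w) + 0))
  ∑-words-suc m f = ∑-concatMap _ (words m) f

  length-∈-words : ∀ {w} m → w ∈ words m → length w ≡ m
  length-∈-words zero (here refl) = refl
  length-∈-words (suc m) w∈ with find (∈-concatMap⁻ _ {xs = words m} w∈)
  ... | v , v∈ , here refl = cong suc (length-∈-words m v∈)
  ... | v , v∈ , there (here refl) = cong suc (length-∈-words m v∈)

  ∈-words : ∀ w → w ∈ words (length w)
  ∈-words [] = here refl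
  ∈-words (s ∷ w) = ∈-concatMap⁺ _ {xs = words (length w)} (Any.map (∈-step s) (∈-words w))
    where
    ∈-step : ∀ s {v} → w ≡ v → (s ∷ w) ∈ (U ∷ v) ∷ (D ∷ v) ∷ []
    ∈-step U refl = here refl
    ∈-step D refl = there (here refl)

  ==ʷ-refl : ∀ w → (w ==ʷ w) ≡ true
  ==ʷ-refl [] = refl
  ==ʷ-refl (U ∷ w) = ==ʷ-refl w
  ==ʷ-refl (D ∷ w) = ==ʷ-refl w

  ==ʷ⇒≡ : ∀ u v → (u ==ʷ v) ≡ true → u ≡ v
  ==ʷ⇒≡ [] [] _ = refl
  ==ʷ⇒≡ (U ∷ u) (U ∷ v) e = cong (U ∷_) (==ʷ⇒≡ u v e)
  ==ʷ⇒≡ (D ∷ u) (D ∷ v) e = cong (D ∷_) (==ʷ⇒≡ u v e)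

  ≢⇒==ʷ-false : ∀ u v → u ≢ v → (u ==ʷ v) ≡ false
  ≢⇒==ʷ-false u v u≢v with u ==ʷ v in eq
  ... | true = ⊥-elim (u≢v (==ʷ⇒≡ u v eq))
  ... | false = refl

  ∑-words-==ʷ : ∀ m R → length R ≡ m → (f : Word → ℕ) → ∑[ Q ∈ words m ] (𝟙 (Q ==ʷ R) * f Q) ≡ f R
  ∑-words-==ʷ zero [] refl f = trans (+-identityʳ _) (+-identityʳ (f []))
  ∑-words-==ʷ (suc m) (s ∷ R) refl f =
    trans (∑-words-suc m _) (trans (∑-cong (words m) (λ w _ → select s w)) (∑-words-==ʷ m R refl (λ w → f (s ∷ w))))
    where
    select : ∀ s w → 𝟙 ((U ∷ w) ==ʷ (s ∷ R)) * f (U ∷ w) + (𝟙 ((D ∷ w) ==ʷ (s ∷ R)) * f (D ∷ w) + 0)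
                   ≡ 𝟙 (w ==ʷ R) * f (s ∷ w)
    select U w = +-identityʳ _
    select D w = +-identityʳ _

  dyckFrom : ℕ → Word → Bool
  dyckFrom h [] = h ≡ᵇ 0
  dyckFrom h (U ∷ w) = dyckFrom (suc h) w
  dyckFrom zero (D ∷ w) = false
  dyckFrom (suc h) (D ∷ w) = dyckFrom h w

  -- The state after a prefix: its final height h, the length d of its final
  -- descent run, and whether it ends with D U.
  accepts : ℕ → ℕ → ℕ → Bool → Word → Bool
  accepts p h d endsDU [] = h ≡ᵇ 0
  accepts p h d endsDU (U ∷ w) = not endsDU ∧ accepts p (suc h) 0 (0 <ᵇ d) w
  accepts p zero d endsDU (D ∷ w) = false
  accepts p (suc h) d endsDU (D ∷ w) = (d <ᵇ p) ∧ accepts p h (suc d) false w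

  Accepts : ℕ → ℕ → ℕ → Bool → Word → Set
  Accepts p h d f w = accepts p h d f w ≡ true

  DUU : Word
  DUU = D ∷ U ∷ U ∷ []

  run : ℕ → Word
  run k = replicate k D

  replicate-++-∷ : ∀ k (x : A) w → replicate k x ++ x ∷ w ≡ replicate (suc k) x ++ w
  replicate-++-∷ zero x w = refl
  replicate-++-∷ (suc k) x w = cong (x ∷_) (replicate-++-∷ k x w)

  data StartsWithoutD : Word → Set where
    [] : StartsWithoutD []
    U∷ : ∀ w → StartsWithoutD (U ∷ w)

  isPrefix-run-short : ∀ {k} d {v} → StartsWithoutD v → d < k → isPrefix (run k) (run d ++ v) ≡ false
  isPrefix-run-short {suc k} zero [] _ = refl
  isPrefix-run-short {suc k} zero (U∷ w) _ = refl
  isPrefix-run-short {suc k} (suc d) v (s≤s d<k) = isPrefix-run-short d v d<k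

  occurs-run-short : ∀ {p} d {v} → StartsWithoutD v → d ≤ p →
    occurs (run (suc p)) (run d ++ v) ≡ occurs (run (suc p)) v
  occurs-run-short zero v _ = refl
  occurs-run-short {p} (suc d) v d<p
    rewrite isPrefix-run-short {suc p} (suc d) v (s≤s d<p) = occurs-run-short d v (<⇒≤ d<p)

  isPrefix-++ : ∀ u v → isPrefix u (u ++ v) ≡ true
  isPrefix-++ [] v = refl
  isPrefix-++ (U ∷ u) v = isPrefix-++ u v
  isPrefix-++ (D ∷ u) v = isPrefix-++ u v

  occurs-run-full : ∀ p w → occurs (run (suc p)) (run p ++ D ∷ w) ≡ true
  occurs-run-full p w rewrite replicate-++-∷ p D w | isPrefix-++ (run p) w = refl

  -- The suffix of the prefix read so far that matters for a later occurrence of D U U.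
  tailDUU : Bool → ℕ → Word
  tailDUU true d = D ∷ U ∷ []
  tailDUU false zero = []
  tailDUU false (suc d) = D ∷ []

  occurs-DUU-tail-D : ∀ f d w → occurs DUU (tailDUU f d ++ D ∷ w) ≡ occurs DUU (D ∷ w)
  occurs-DUU-tail-D true d w = refl
  occurs-DUU-tail-D false zero w = refl
  occurs-DUU-tail-D false (suc d) w = refl

  occurs-DUU-tail-U : ∀ d w → occurs DUU (tailDUU false d ++ U ∷ w) ≡ occurs DUU (tailDUU (0 <ᵇ d) 0 ++ w)
  occurs-DUU-tail-U zero w = refl
  occurs-DUU-tail-U (suc d) w = refl

  occurs-DUU-tail-[] : ∀ f d → occurs DUU (tailDUU f d ++ []) ≡ false
  occurs-DUU-tail-[] true d = refl
  occurs-DUU-tail-[] false zero = refl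
  occurs-DUU-tail-[] false (suc d) = refl

  accepts-spec : ∀ p h d f w → d ≤ p →
    accepts p h d f w ≡ dyckFrom h w ∧ not (occurs DUU (tailDUU f d ++ w)) ∧ not (occurs (run (suc p)) (run d ++ w))
  accepts-spec p h d f [] d≤p
    rewrite occurs-DUU-tail-[] f d | occurs-run-short d [] d≤p = sym (∧-identityʳ _)
  accepts-spec p h d true (U ∷ w) d≤p = sym (∧-zeroʳ _)
  accepts-spec p h d false (U ∷ w) d≤p
    rewrite occurs-DUU-tail-U d w | occurs-run-short d (U∷ w) d≤p = accepts-spec p (suc h) 0 (0 <ᵇ d) w z≤n
  accepts-spec p zero d f (D ∷ w) d≤p = refl
  accepts-spec p (suc h) d f (D ∷ w) d≤p
    rewrite occurs-DUU-tail-D f d w with m≤n⇒m<n∨m≡n d≤p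
  ... | inj₁ d<p rewrite ≤ᵇ-true d<p | replicate-++-∷ d D w = accepts-spec p h (suc d) false w d<p
  ... | inj₂ refl rewrite occurs-run-full d w | ≤ᵇ-false {suc d} {d} ≤-refl =
    sym (trans (cong (dyckFrom h w ∧_) (∧-zeroʳ _)) (∧-zeroʳ _))

  isDyck-from : ∀ h w → dyckFrom h w ≡
    all (λ x → (ℤ.+ 0) ℤ.≤ᵇ x) (heightsFrom (ℤ.+ h) w) ∧ ⌊ ((ℤ.+ h) ℤ.+ sumℤ (map stepVal w)) ℤ.≟ (ℤ.+ 0) ⌋
  isDyck-from h [] rewrite +-identityʳ h = final h
    where
    final : ∀ m → (m ≡ᵇ 0) ≡ ⌊ (ℤ.+ m) ℤ.≟ (ℤ.+ 0) ⌋
    final zero = refl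
    final (suc m) = refl
  isDyck-from h (U ∷ w) rewrite sym (ℤP.+-assoc (ℤ.+ h) (ℤ.+ 1) (sumℤ (map stepVal w))) | +-comm h 1 = isDyck-from (suc h) w
  isDyck-from zero (D ∷ w) = refl
  isDyck-from (suc h) (D ∷ w) rewrite sym (ℤP.+-assoc (ℤ.+ suc h) (ℤ.- (ℤ.+ 1)) (sumℤ (map stepVal w))) = isDyck-from h w

  inF≡accepts : ∀ p w → inF p w ≡ accepts p 0 0 false w
  inF≡accepts p w
    rewrite accepts-spec p 0 0 false w z≤n | isDyck-from 0 w | ℤP.+-identityˡ (sumℤ (map stepVal w)) = refl

  accepts⇒dyckFrom : ∀ {p h d f} w → Accepts p h d f w → dyckFrom h w ≡ true
  accepts⇒dyckFrom [] e = e
  accepts⇒dyckFrom {f = f} (U ∷ w) e = accepts⇒dyckFrom w (proj₂ (∧-true⁻ {not f} e))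
  accepts⇒dyckFrom {p} {suc h} {d} (D ∷ w) e = accepts⇒dyckFrom w (proj₂ (∧-true⁻ {d <ᵇ p} e))

  -- The Stanley order

  -- Below x k P Q: starting at heights x and x + 2k, the path P stays weakly below Q.
  data Below : ℕ → ℕ → Word → Word → Set where
    [] : ∀ {x k} → Below x k [] []
    uu : ∀ {x k P Q} → Below (suc x) k P Q → Below x k (U ∷ P) (U ∷ Q)
    dd : ∀ {x k P Q} → Below x k P Q → Below (suc x) k (D ∷ P) (D ∷ Q)
    du : ∀ {x k P Q} → Below x (suc k) P Q → Below (suc x) k (D ∷ P) (U ∷ Q)
    ud : ∀ {x k P Q} → Below (suc x) k P Q → Below x (suc k) (U ∷ P) (D ∷ Q)

  Below-length : ∀ {x k P Q} → Below x k P Q → length P ≡ length Q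
  Below-length [] = refl
  Below-length (uu b) = cong suc (Below-length b)
  Below-length (dd b) = cong suc (Below-length b)
  Below-length (du b) = cong suc (Below-length b)
  Below-length (ud b) = cong suc (Below-length b)

  Below-refl : ∀ x w → dyckFrom x w ≡ true → Below x 0 w w
  Below-refl x [] _ = []
  Below-refl x (U ∷ w) e = uu (Below-refl (suc x) w e)
  Below-refl (suc x) (D ∷ w) e = dd (Below-refl x w e)

  Below-antisym : ∀ {x P Q} → Below x 0 P Q → Below x 0 Q P → P ≡ Q
  Below-antisym [] [] = refl
  Below-antisym (uu b) (uu b′) = cong (U ∷_) (Below-antisym b b′)
  Below-antisym (dd b) (dd b′) = cong (D ∷_) (Below-antisym b b′)

  heightsBelow : ℕ → ℕ → Word → Word → Bool
  heightsBelow x k P Q = and (zipWith ℤ._≤ᵇ_ (heightsFrom (ℤ.+ x) P) (heightsFrom (ℤ.+ (x + (k + k))) Q))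

  +-suc-double : ∀ x k → suc (suc (x + (k + k))) ≡ x + (suc k + suc k)
  +-suc-double x k = trans (cong suc (sym (+-suc x (k + k))))
                       (trans (sym (+-suc x (suc (k + k)))) (cong (λ z → x + suc z) (sym (+-suc k k))))

  heightsBelow-uu : ∀ x k P Q → heightsBelow x k (U ∷ P) (U ∷ Q) ≡ ((suc x ≤ᵇ suc (x + (k + k))) ∧ heightsBelow (suc x) k P Q)
  heightsBelow-uu x k P Q rewrite +-comm x 1 | +-comm (x + (k + k)) 1 = refl

  heightsBelow-du : ∀ x k P Q → heightsBelow (suc x) k (D ∷ P) (U ∷ Q) ≡ ((x ≤ᵇ x + (suc k + suc k)) ∧ heightsBelow x (suc k) P Q)
  heightsBelow-du x k P Q rewrite +-comm (suc x + (k + k)) 1 | +-suc-double x k = refl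

  heightsBelow-ud : ∀ x k P Q → heightsBelow x (suc k) (U ∷ P) (D ∷ Q) ≡ ((suc x ≤ᵇ suc (x + (k + k))) ∧ heightsBelow (suc x) k P Q)
  heightsBelow-ud x k P Q rewrite +-comm x 1 | sym (+-suc-double x k) = refl

  Below⇒heightsBelow : ∀ {x k P Q} → Below x k P Q → heightsBelow x k P Q ≡ true
  Below⇒heightsBelow [] = refl
  Below⇒heightsBelow {x} {k} (uu {P = P} {Q = Q} b)
    rewrite heightsBelow-uu x k P Q | ≤ᵇ-true (m≤m+n (suc x) (k + k)) = Below⇒heightsBelow b
  Below⇒heightsBelow {suc x} {k} (dd b) rewrite ≤ᵇ-true (m≤m+n x (k + k)) = Below⇒heightsBelow b
  Below⇒heightsBelow {suc x} {k} (du {P = P} {Q = Q} b)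
    rewrite heightsBelow-du x k P Q | ≤ᵇ-true (m≤m+n x (suc k + suc k)) = Below⇒heightsBelow b
  Below⇒heightsBelow {x} {suc k} (ud {P = P} {Q = Q} b)
    rewrite heightsBelow-ud x k P Q | ≤ᵇ-true (m≤m+n (suc x) (k + k)) = Below⇒heightsBelow b

  heightsBelow⇒Below : ∀ x k P Q → dyckFrom x P ≡ true → dyckFrom (x + (k + k)) Q ≡ true →
    length P ≡ length Q → heightsBelow x k P Q ≡ true → Below x k P Q
  heightsBelow⇒Below x k [] [] _ _ _ _ = []
  heightsBelow⇒Below x k (U ∷ P) (U ∷ Q) dP dQ l h rewrite heightsBelow-uu x k P Q =
    uu (heightsBelow⇒Below (suc x) k P Q dP dQ (suc-injective l) (proj₂ (∧-true⁻ h)))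
  heightsBelow⇒Below (suc x) k (D ∷ P) (D ∷ Q) dP dQ l h =
    dd (heightsBelow⇒Below x k P Q dP dQ (suc-injective l) (proj₂ (∧-true⁻ h)))
  heightsBelow⇒Below (suc x) k (D ∷ P) (U ∷ Q) dP dQ l h rewrite heightsBelow-du x k P Q =
    du (heightsBelow⇒Below x (suc k) P Q dP (subst (λ y → dyckFrom y Q ≡ true) (+-suc-double x k) dQ)
         (suc-injective l) (proj₂ (∧-true⁻ h)))
  heightsBelow⇒Below zero zero (U ∷ P) (D ∷ Q) _ () _ _
  heightsBelow⇒Below (suc x) zero (U ∷ P) (D ∷ Q) _ _ _ h rewrite +-identityʳ x | +-comm x 1 =
    ⊥-elim (<-irrefl refl (≤-trans (≤ᵇ-true⁻ (proj₁ (∧-true⁻ h))) (n≤1+n x)))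
  heightsBelow⇒Below x (suc k) (U ∷ P) (D ∷ Q) dP dQ l h rewrite heightsBelow-ud x k P Q =
    ud (heightsBelow⇒Below (suc x) k P Q dP (subst (λ y → dyckFrom y (D ∷ Q) ≡ true) (sym (+-suc-double x k)) dQ)
         (suc-injective l) (proj₂ (∧-true⁻ h)))

  ≤ˢ⇒Below : ∀ P Q → dyckFrom 0 P ≡ true → dyckFrom 0 Q ≡ true → (P ≤ˢ Q) ≡ true → Below 0 0 P Q
  ≤ˢ⇒Below P Q dP dQ e with ∧-true⁻ {⌊ length P ℕ.≟ length Q ⌋} e
  ... | l , h = heightsBelow⇒Below 0 0 P Q dP dQ (⌊≟⌋-true⁻ l) h

  Below⇒≤ˢ : ∀ {P Q} → Below 0 0 P Q → (P ≤ˢ Q) ≡ true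
  Below⇒≤ˢ {P} {Q} b rewrite Below-length b = ∧-true⁺ (⌊≟⌋-refl (length Q)) (Below⇒heightsBelow b)

  -- Valley flips

  data Flip : Word → Word → Set where
    valley : ∀ w → Flip (D ∷ U ∷ w) (U ∷ D ∷ w)
    _∷_ : ∀ s {P R} → Flip P R → Flip (s ∷ P) (s ∷ R)

  flips : Word → List Word
  flips [] = []
  flips (D ∷ U ∷ w) = (U ∷ D ∷ w) ∷ map (D ∷_) (flips (U ∷ w))
  flips (s ∷ w) = map (s ∷_) (flips w)

  Flip⇒∈ : ∀ {P R} → Flip P R → R ∈ flips P
  Flip⇒∈ (valley w) = here refl
  Flip⇒∈ (U ∷ f) = ∈-map⁺ (U ∷_) (Flip⇒∈ f)
  Flip⇒∈ (D ∷ valley w) = ∈-map⁺ (D ∷_) (here refl)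
  Flip⇒∈ (D ∷ (U ∷ f)) = there (∈-map⁺ (D ∷_) (Flip⇒∈ (U ∷ f)))
  Flip⇒∈ (D ∷ (D ∷ f)) = ∈-map⁺ (D ∷_) (Flip⇒∈ (D ∷ f))

  ∈⇒Flip : ∀ P {R} → R ∈ flips P → Flip P R
  ∈⇒Flip (U ∷ P) R∈ with ∈-map⁻ (U ∷_) R∈
  ... | R′ , R′∈ , refl = U ∷ ∈⇒Flip P R′∈
  ∈⇒Flip (D ∷ U ∷ w) (here refl) = valley w
  ∈⇒Flip (D ∷ U ∷ w) (there R∈) with ∈-map⁻ (D ∷_) R∈
  ... | R′ , R′∈ , refl = D ∷ ∈⇒Flip (U ∷ w) R′∈
  ∈⇒Flip (D ∷ D ∷ w) R∈ with ∈-map⁻ (D ∷_) R∈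
  ... | R′ , R′∈ , refl = D ∷ ∈⇒Flip (D ∷ w) R′∈

  Flip⇒Below : ∀ {x P R} → dyckFrom x P ≡ true → Flip P R → Below x 0 P R
  Flip⇒Below {suc x} e (valley w) = du (ud (Below-refl (suc x) w e))
  Flip⇒Below e (U ∷ f) = uu (Flip⇒Below e f)
  Flip⇒Below {suc x} e (D ∷ f) = dd (Flip⇒Below e f)

  Flip⇒≢ : ∀ {P R} → Flip P R → P ≢ R
  Flip⇒≢ (valley w) ()
  Flip⇒≢ (s ∷ f) refl = Flip⇒≢ f refl

  Flip-between : ∀ {x P Q R} → Flip P Q → Below x 0 P R → Below x 0 R Q → R ≡ P ⊎ R ≡ Q
  Flip-between (valley w) (dd (uu b)) (du (ud b′)) = inj₁ (cong (λ t → D ∷ U ∷ t) (Below-antisym b′ b))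
  Flip-between (valley w) (du (ud b)) (uu (dd b′)) = inj₂ (cong (λ t → U ∷ D ∷ t) (Below-antisym b′ b))
  Flip-between (valley w) (du (uu b)) (uu ())
  Flip-between (U ∷ f) (uu b) (uu b′) with Flip-between f b b′
  ... | inj₁ refl = inj₁ refl
  ... | inj₂ refl = inj₂ refl
  Flip-between (D ∷ f) (dd b) (dd b′) with Flip-between f b b′
  ... | inj₁ refl = inj₁ refl
  ... | inj₂ refl = inj₂ refl

  multiplicity : Word → List Word → ℕ
  multiplicity Q L = ∑[ R ∈ L ] 𝟙 (Q ==ʷ R)

  ∈⇒multiplicity-pos : ∀ {Q L} → Q ∈ L → 1 ≤ multiplicity Q L
  ∈⇒multiplicity-pos {Q} (here refl) rewrite ==ʷ-refl Q = s≤s z≤n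
  ∈⇒multiplicity-pos {Q} {R ∷ L} (there Q∈L) = ≤-trans (∈⇒multiplicity-pos Q∈L) (m≤n+m _ (𝟙 (Q ==ʷ R)))

  multiplicity-pos⇒∈ : ∀ Q L → 1 ≤ multiplicity Q L → Q ∈ L
  multiplicity-pos⇒∈ Q (R ∷ L) pos with Q ==ʷ R in eq
  ... | true = here (==ʷ⇒≡ Q R eq)
  ... | false = there (multiplicity-pos⇒∈ Q L pos)

  𝟙-∧ : ∀ a b → 𝟙 (a ∧ b) ≡ 𝟙 a * 𝟙 b
  𝟙-∧ true b = sym (+-identityʳ (𝟙 b))
  𝟙-∧ false b = refl

  𝟙≤1 : ∀ b → 𝟙 b ≤ 1
  𝟙≤1 true = ≤-refl
  𝟙≤1 false = z≤n

  𝟙*≤ : ∀ b c → 𝟙 b * c ≤ c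
  𝟙*≤ true c = ≤-reflexive (+-identityʳ c)
  𝟙*≤ false c = z≤n

  multiplicity-map-∷ : ∀ s t Q L → multiplicity (t ∷ Q) (map (s ∷_) L) ≡ 𝟙 (t ==ˢ s) * multiplicity Q L
  multiplicity-map-∷ s t Q L =
    trans (∑-map (s ∷_) L _) (trans (∑-cong L (λ R _ → 𝟙-∧ (t ==ˢ s) (Q ==ʷ R))) (∑-*ˡ L (𝟙 (t ==ˢ s)) _))

  multiplicity-map-[] : ∀ s L → multiplicity [] (map (s ∷_) L) ≡ 0
  multiplicity-map-[] s L = trans (∑-map (s ∷_) L _) (∑-zero L _ (λ _ _ → refl))

  multiplicity-map≤1 : ∀ s L → (∀ Q → multiplicity Q L ≤ 1) → ∀ Q → multiplicity Q (map (s ∷_) L) ≤ 1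
  multiplicity-map≤1 s L ≤1 [] rewrite multiplicity-map-[] s L = z≤n
  multiplicity-map≤1 s L ≤1 (t ∷ Q) rewrite multiplicity-map-∷ s t Q L = ≤-trans (𝟙*≤ (t ==ˢ s) _) (≤1 Q)

  multiplicity-flips≤1 : ∀ P Q → multiplicity Q (flips P) ≤ 1
  multiplicity-flips≤1 [] Q = z≤n
  multiplicity-flips≤1 (U ∷ P) = multiplicity-map≤1 U (flips P) (multiplicity-flips≤1 P)
  multiplicity-flips≤1 (D ∷ []) Q = z≤n
  multiplicity-flips≤1 (D ∷ w@(D ∷ _)) = multiplicity-map≤1 D (flips w) (multiplicity-flips≤1 w)
  multiplicity-flips≤1 (D ∷ w@(U ∷ _)) [] rewrite multiplicity-map-[] D (flips w) = z≤n
  multiplicity-flips≤1 (D ∷ w@(U ∷ _)) (U ∷ Q) rewrite multiplicity-map-∷ D U Q (flips w) =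
    subst (_≤ 1) (sym (+-identityʳ _)) (𝟙≤1 _)
  multiplicity-flips≤1 (D ∷ w@(U ∷ _)) (D ∷ Q) =
    ≤-trans (≤-reflexive (multiplicity-map-∷ D D Q (flips w))) (≤-trans (𝟙*≤ true _) (multiplicity-flips≤1 w Q))

  acceptedFlips : ℕ → ℕ → ℕ → Bool → Word → ℕ
  acceptedFlips p h d f X = ∑[ R ∈ flips X ] 𝟙 (accepts p h d f R)

  leadingDs : Word → ℕ
  leadingDs (D ∷ w) = suc (leadingDs w)
  leadingDs _ = 0

  -- GapAfterD k j y: a step D of the lower path against a step y of the upper
  -- one turns the gap j into suc k.
  data GapAfterD (k : ℕ) : ℕ → Step → Set where
    vsU : GapAfterD k k U
    vsD : GapAfterD k (suc k) D

  Below-D∷ : ∀ {k j y x P Q} → GapAfterD k j y → Below x (suc k) P Q → Below (suc x) j (D ∷ P) (y ∷ Q)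
  Below-D∷ vsU b = du b
  Below-D∷ vsD b = dd b

  Below-UD∷ : ∀ {k j y x P Q} → GapAfterD k j y → Below x (suc k) (U ∷ P) Q → Below (suc x) j (U ∷ D ∷ P) (y ∷ Q)
  Below-UD∷ vsU (uu b) = uu (du b)
  Below-UD∷ vsU (ud b) = uu (dd b)
  Below-UD∷ vsD (uu b) = ud (du b)
  Below-UD∷ vsD (ud b) = ud (dd b)

  module CoversInF {p : ℕ} (2≤p : 2 ≤ p) where

    accepts-run-extend : ∀ h d w → Accepts p h (suc d) false w → leadingDs w + suc (suc d) ≤ p →
      Accepts p h (suc (suc d)) false w
    accepts-run-extend h d [] acc _ = acc
    accepts-run-extend h d (U ∷ w) acc _ = acc
    accepts-run-extend (suc h) d (D ∷ w) acc fits =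
      ∧-true⁺ (<ᵇ-true (≤-trans (s≤s (m≤n+m (suc (suc d)) (leadingDs w))) fits))
              (accepts-run-extend h (suc d) w (proj₂ (∧-true⁻ acc)) (subst (_≤ p) (sym (+-suc (leadingDs w) (suc (suc d)))) fits))

    accepts⇒leadingDs≤ : ∀ h d f w → Accepts p h d f w → d ≤ p → leadingDs w + d ≤ p
    accepts⇒leadingDs≤ h d f [] _ d≤p = d≤p
    accepts⇒leadingDs≤ h d f (U ∷ w) _ d≤p = d≤p
    accepts⇒leadingDs≤ (suc h) d f (D ∷ w) acc _ with ∧-true⁻ acc
    ... | d<p , acc′ = subst (_≤ p) (+-suc (leadingDs w) d) (accepts⇒leadingDs≤ h (suc d) false w acc′ (<ᵇ-true⁻ d<p))

    -- A flip of D ∷ P lying below y ∷ Q, whichever step y the upper path takes.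
    FlipUnder : ℕ → ℕ → ℕ → Word → Word → Set
    FlipUnder x d k P Q = Σ Word λ R → Flip (D ∷ P) R × Accepts p (suc x) d false R ×
                                       (∀ {j y} → GapAfterD k j y → Below (suc x) j R (y ∷ Q))

    FlipBelowFrom : ℕ → ℕ → Bool → ℕ → Word → Word → Set
    FlipBelowFrom h d f m P Q = Σ Word λ R → Flip P R × Accepts p h d f R × Below h m R Q

    -- Walking along P where it is strictly below Q, the first valley of P can be
    -- flipped unless the descent run following it already has length p; then Q
    -- stays strictly above that whole run and the search resumes after it.
    mutual
      flipUnder : ∀ P {x k d Q qh dq fq} → Below x (suc k) P Q → (d <ᵇ p) ≡ true → Accepts p x (suc d) false P →
        Accepts p qh dq fq Q → qh ≡ x + (suc k + suc k) → FlipUnder x d k P Q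
      flipUnder [] {zero} [] _ _ accQ qh≡ with trans (sym qh≡) (≡ᵇ0⁻ accQ)
      ... | ()
      flipUnder (D ∷ P) {suc x} {k} {d} {D ∷ Q} {suc qh} (dd b) d<p accP accQ qh≡
        with flipUnder P {x} {k} {suc d} b (proj₁ (∧-true⁻ accP)) (proj₂ (∧-true⁻ accP)) (proj₂ (∧-true⁻ accQ)) (suc-injective qh≡)
      ... | R , fl , accR , bl = D ∷ R , D ∷ fl , ∧-true⁺ d<p accR , λ g → Below-D∷ g (bl vsD)
      flipUnder (D ∷ P) {suc x} {k} {d} {U ∷ Q} {qh} {dq} {false} (du b) d<p accP accQ qh≡
        with flipUnder P {x} {suc k} {suc d} b (proj₁ (∧-true⁻ accP)) (proj₂ (∧-true⁻ accP)) accQ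
               (trans (cong suc qh≡) (+-suc-double x (suc k)))
      ... | R , fl , accR , bl = D ∷ R , D ∷ fl , ∧-true⁺ d<p accR , λ g → Below-D∷ g (bl vsU)
      flipUnder (U ∷ D ∷ P) {x} {k} {d} {Q} {qh} {dq} {fq} b d<p accP accQ qh≡ with leadingDs P + 2 ≤? p
      ... | yes fits = U ∷ D ∷ D ∷ P , valley (D ∷ P) ,
                       ∧-true⁺ (proj₁ accP′) (∧-true⁺ (<ᵇ-true 2≤p) (accepts-run-extend x 0 P (proj₂ accP′) fits)) ,
                       λ g → Below-UD∷ g b
        where
        accP′ : (0 <ᵇ p) ≡ true × Accepts p x 1 false P
        accP′ = ∧-true⁻ {0 <ᵇ p} accP
      ... | no ¬fits = fullRun Q qh dq fq b accQ qh≡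
        where
        runIsFull : suc (leadingDs P) ≡ p
        runIsFull = ≤-antisym
          (subst (_≤ p) (+-comm (leadingDs P) 1) (accepts⇒leadingDs≤ x 1 false P (proj₂ (∧-true⁻ {0 <ᵇ p} accP)) (≤-trans (s≤s z≤n) 2≤p)))
          (≮⇒≥ (λ lt → ¬fits (subst (_≤ p) (+-comm 2 (leadingDs P)) lt)))
        fullRun : ∀ Q qh dq fq → Below x (suc k) (U ∷ D ∷ P) Q → Accepts p qh dq fq Q → qh ≡ x + (suc k + suc k) →
          FlipUnder x d k (U ∷ D ∷ P) Q
        fullRun (U ∷ Q) qh dq false (uu b) accQ qh≡
          with flipUnderFullRun P {suc x} {0} {true} {suc k} {Q} {suc qh} accP (λ _ → refl) runIsFull b accQ (cong suc qh≡) (λ ())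
        ... | R , fl , accR , bl = D ∷ U ∷ R , D ∷ (U ∷ fl) , ∧-true⁺ d<p accR , λ g → Below-D∷ g (uu bl)
        fullRun (D ∷ Q) (suc qh) dq fq (ud b) accQ qh≡
          with flipUnderFullRun P {suc x} {0} {true} {k} {Q} {qh} accP (λ _ → refl) runIsFull b (proj₂ (∧-true⁻ accQ))
                 (suc-injective (trans qh≡ (sym (+-suc-double x k)))) (λ _ → s≤s z≤n)
        ... | R , fl , accR , bl = D ∷ U ∷ R , D ∷ (U ∷ fl) , ∧-true⁺ d<p accR , λ g → Below-D∷ g (ud bl)

      flipUnderFullRun : ∀ P {h d f m Q hq dq fq} → Accepts p h d f (D ∷ P) → (f ≡ true → d ≡ 0) → d + leadingDs (D ∷ P) ≡ p →
        Below h m (D ∷ P) Q → Accepts p hq dq fq Q → hq ≡ h + (m + m) → (m ≡ 0 → d < dq) → FlipBelowFrom h d f m (D ∷ P) Q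
      flipUnderFullRun (D ∷ P) {suc h} {d} {f} {m} {D ∷ Q} {suc hq} {dq} accP _ full (dd b) accQ hq≡ touch
        with flipUnderFullRun P {h} {suc d} {false} {m} {Q} {hq} {suc dq} (proj₂ (∧-true⁻ accP)) (λ ())
               (trans (sym (+-suc d (suc (leadingDs P)))) full) b (proj₂ (∧-true⁻ accQ)) (suc-injective hq≡)
               (λ m≡0 → s≤s (touch m≡0))
      ... | R , fl , accR , bl = D ∷ R , D ∷ fl , ∧-true⁺ (proj₁ (∧-true⁻ accP)) accR , dd bl
      flipUnderFullRun (D ∷ P) {suc h} {d} {f} {m} {U ∷ Q} {hq} {dq} {false} accP _ full (du b) accQ hq≡ _
        with flipUnderFullRun P {h} {suc d} {false} {suc m} {Q} {suc hq} (proj₂ (∧-true⁻ accP)) (λ ())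
               (trans (sym (+-suc d (suc (leadingDs P)))) full) b accQ (trans (cong suc hq≡) (+-suc-double h m)) (λ ())
      ... | R , fl , accR , bl = D ∷ R , D ∷ fl , ∧-true⁺ (proj₁ (∧-true⁻ accP)) accR , du bl
      flipUnderFullRun [] = flipUnderRunEnd [] refl
      flipUnderFullRun (U ∷ P) = flipUnderRunEnd (U ∷ P) refl

      flipUnderRunEnd : ∀ P → leadingDs P ≡ 0 → ∀ {h d f m Q hq dq fq} → Accepts p h d f (D ∷ P) → (f ≡ true → d ≡ 0) →
        d + leadingDs (D ∷ P) ≡ p → Below h m (D ∷ P) Q → Accepts p hq dq fq Q → hq ≡ h + (m + m) → (m ≡ 0 → d < dq) →
        FlipBelowFrom h d f m (D ∷ P) Q
      flipUnderRunEnd P noD {suc h} {d} {true} _ d≡0 full _ _ _ _ with d≡0 refl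
      ... | refl = ⊥-elim (<-irrefl refl (subst (2 ≤_) (trans (sym full) (cong suc noD)) 2≤p))
      flipUnderRunEnd P noD {suc h} {d} {false} {zero} {D ∷ Q} {suc hq} {dq} _ _ full (dd _) accQ _ touch =
        ⊥-elim (<-irrefl refl (≤-trans (<ᵇ-true⁻ (proj₁ (∧-true⁻ accQ))) (subst (_≤ dq) d+1≡p (touch refl))))
        where
        d+1≡p : suc d ≡ p
        d+1≡p = trans (trans (cong suc (sym (+-identityʳ d))) (sym (+-suc d 0))) (trans (cong (λ z → d + suc z) (sym noD)) full)
      flipUnderRunEnd P noD {suc h} {d} {false} {suc k} {D ∷ Q} {suc hq} {dq} accP _ _ (dd b) accQ hq≡ _
        with flipUnder P {h} {k} {d} b (proj₁ (∧-true⁻ accP)) (proj₂ (∧-true⁻ accP)) (proj₂ (∧-true⁻ accQ)) (suc-injective hq≡)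
      ... | R , fl , accR , bl = R , fl , accR , bl vsD
      flipUnderRunEnd P noD {suc h} {d} {false} {m} {U ∷ Q} {hq} {dq} {false} accP _ _ (du b) accQ hq≡ _
        with flipUnder P {h} {m} {d} b (proj₁ (∧-true⁻ accP)) (proj₂ (∧-true⁻ accP)) accQ (trans (cong suc hq≡) (+-suc-double h m))
      ... | R , fl , accR , bl = R , fl , accR , bl vsU

    flipBelow : ∀ h d f P Q → Accepts p h d f P → Accepts p h d f Q → Below h 0 P Q → P ≢ Q → FlipBelowFrom h d f 0 P Q
    flipBelow h d f [] [] _ _ [] P≢Q = ⊥-elim (P≢Q refl)
    flipBelow h d false (U ∷ P) (U ∷ Q) accP accQ (uu b) P≢Q
      with flipBelow (suc h) 0 (0 <ᵇ d) P Q accP accQ b (λ P≡Q → P≢Q (cong (U ∷_) P≡Q))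
    ... | R , fl , accR , bl = U ∷ R , U ∷ fl , accR , uu bl
    flipBelow (suc h) d f (D ∷ P) (D ∷ Q) accP accQ (dd b) P≢Q
      with flipBelow h (suc d) false P Q (proj₂ (∧-true⁻ accP)) (proj₂ (∧-true⁻ accQ)) b (λ P≡Q → P≢Q (cong (D ∷_) P≡Q))
    ... | R , fl , accR , bl = D ∷ R , D ∷ fl , ∧-true⁺ (proj₁ (∧-true⁻ accP)) accR , dd bl
    flipBelow (suc h) d false (D ∷ P) (U ∷ Q) accP accQ (du b) _
      with flipUnder P {h} {0} {d} b (proj₁ (∧-true⁻ accP)) (proj₂ (∧-true⁻ accP)) accQ (+-comm 2 h)
    ... | R , fl , accR , bl = R , fl , accR , bl vsU

    ∈F⁻ : ∀ n {R} → R ∈ F p n → length R ≡ n + n × Accepts p 0 0 false R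
    ∈F⁻ n {R} R∈ with ∈-filter⁻ (λ w → inF p w ≟ᵇ true) {xs = words (n + n)} R∈
    ... | R∈words , inR = length-∈-words (n + n) R∈words , trans (sym (inF≡accepts p R)) inR

    ∈F⁺ : ∀ n R → length R ≡ n + n → Accepts p 0 0 false R → R ∈ F p n
    ∈F⁺ n R len acc =
      ∈-filter⁺ (λ w → inF p w ≟ᵇ true) (subst (λ m → R ∈ words m) len (∈-words R)) (trans (inF≡accepts p R) acc)

    <ˢ⇒Below : ∀ P Q → Accepts p 0 0 false P → Accepts p 0 0 false Q → (P <ˢ Q) ≡ true → Below 0 0 P Q
    <ˢ⇒Below P Q accP accQ P<Q =
      ≤ˢ⇒Below P Q (accepts⇒dyckFrom P accP) (accepts⇒dyckFrom Q accQ) (proj₁ (∧-true⁻ {P ≤ˢ Q} P<Q))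

    <ˢ⇒≢ : ∀ P Q → (P <ˢ Q) ≡ true → P ≢ Q
    <ˢ⇒≢ P Q P<Q refl with trans (sym (cong not (==ʷ-refl P))) (proj₂ (∧-true⁻ {P ≤ˢ P} P<Q))
    ... | ()

    Flip⇒<ˢ : ∀ {P R} → Accepts p 0 0 false P → Flip P R → (P <ˢ R) ≡ true
    Flip⇒<ˢ {P} {R} acc fl rewrite ≢⇒==ʷ-false P R (Flip⇒≢ fl) =
      ∧-true⁺ (Below⇒≤ˢ (Flip⇒Below (accepts⇒dyckFrom P acc) fl)) refl

    strictlyBetween : ℕ → Word → Word → Bool
    strictlyBetween n P Q = any (λ R → (P <ˢ R) ∧ (R <ˢ Q)) (F p n)

    Flip⇒covers : ∀ n {P Q} → Accepts p 0 0 false P → Accepts p 0 0 false Q → Flip P Q → covers p n P Q ≡ true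
    Flip⇒covers n {P} {Q} accP accQ fl rewrite Flip⇒<ˢ accP fl with strictlyBetween n P Q in between
    ... | false = refl
    ... | true with find (any⁻ _ (F p n) (≡true⇒T between))
    ... | R , R∈F , P<R<Q with ∧-true⁻ (T⇒≡true P<R<Q) | proj₂ (∈F⁻ n R∈F)
    ... | P<R , R<Q | accR with Flip-between fl (<ˢ⇒Below P R accP accR P<R) (<ˢ⇒Below R Q accR accQ R<Q)
    ... | inj₁ refl = ⊥-elim (<ˢ⇒≢ P P P<R refl)
    ... | inj₂ refl = ⊥-elim (<ˢ⇒≢ Q Q R<Q refl)

    covers⇒Flip : ∀ n P Q → P ∈ F p n → Accepts p 0 0 false Q → covers p n P Q ≡ true → Flip P Q
    covers⇒Flip n P Q P∈F accQ cov with ∈F⁻ n P∈F | ∧-true⁻ {P <ˢ Q} cov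
    ... | lenP , accP | P<Q , nothingBetween
      with flipBelow 0 0 false P Q accP accQ (<ˢ⇒Below P Q accP accQ P<Q) (<ˢ⇒≢ P Q P<Q)
    ... | R , fl , accR , R≤Q with R ==ʷ Q in R==Q
    ... | true = subst (Flip P) (==ʷ⇒≡ R Q R==Q) fl
    ... | false = contradiction (trans (sym (cong not somethingBetween)) nothingBetween) λ ()
      where
      lenR : length R ≡ n + n
      lenR = trans (sym (Below-length (Flip⇒Below (accepts⇒dyckFrom P accP) fl))) lenP
      P<R<Q : ((P <ˢ R) ∧ (R <ˢ Q)) ≡ true
      P<R<Q = ∧-true⁺ (Flip⇒<ˢ accP fl) (∧-true⁺ (Below⇒≤ˢ R≤Q) (cong not R==Q))
      somethingBetween : strictlyBetween n P Q ≡ true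
      somethingBetween = T⇒≡true (any⁺ _ (Any.map (λ { refl → ≡true⇒T P<R<Q }) (∈F⁺ n R lenR accR)))

    𝟙-covers : ∀ n P Q → P ∈ F p n → 𝟙 (inF p Q) * 𝟙 (covers p n P Q) ≡ 𝟙 (inF p Q) * multiplicity Q (flips P)
    𝟙-covers n P Q P∈F with inF p Q in inQ
    ... | false = refl
    ... | true with covers p n P Q in cov
    ... | true = cong (1 *_) (sym (≤-antisym (multiplicity-flips≤1 P Q)
                                             (∈⇒multiplicity-pos (Flip⇒∈ (covers⇒Flip n P Q P∈F accQ cov)))))
      where
      accQ : Accepts p 0 0 false Q
      accQ = trans (sym (inF≡accepts p Q)) inQ
    ... | false with multiplicity Q (flips P) in cnt
    ... | zero = refl
    ... | suc _ with trans (sym cov) (Flip⇒covers n (proj₂ (∈F⁻ n P∈F)) (trans (sym (inF≡accepts p Q)) inQ)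
                                        (∈⇒Flip P (multiplicity-pos⇒∈ Q (flips P) (subst (1 ≤_) (sym cnt) (s≤s z≤n)))))
    ... | ()

    coversOf≡acceptedFlips : ∀ n P → P ∈ F p n →
      ∑[ Q ∈ words (n + n) ] (𝟙 (inF p Q) * (𝟙 (covers p n P Q) * 1)) ≡ acceptedFlips p 0 0 false P
    coversOf≡acceptedFlips n P P∈F = begin
        ∑[ Q ∈ W ] (𝟙 (inF p Q) * (𝟙 (covers p n P Q) * 1))
      ≡⟨ ∑-cong W (λ Q _ → trans (cong (𝟙 (inF p Q) *_) (*-identityʳ _)) (𝟙-covers n P Q P∈F)) ⟩
        ∑[ Q ∈ W ] (𝟙 (inF p Q) * multiplicity Q (flips P))
      ≡⟨ ∑-cong W (λ Q _ → trans (sym (∑-*ˡ (flips P) (𝟙 (inF p Q)) _)) (∑-cong (flips P) (λ R _ → *-comm (𝟙 (inF p Q)) _))) ⟩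
        ∑[ Q ∈ W ] ∑[ R ∈ flips P ] (𝟙 (Q ==ʷ R) * 𝟙 (inF p Q))
      ≡⟨ ∑-swap W (flips P) _ ⟩
        ∑[ R ∈ flips P ] ∑[ Q ∈ W ] (𝟙 (Q ==ʷ R) * 𝟙 (inF p Q))
      ≡⟨ ∑-cong (flips P) (λ R R∈ → trans (∑-words-==ʷ (n + n) R (lenR R R∈) (λ Q → 𝟙 (inF p Q))) (cong 𝟙 (inF≡accepts p R))) ⟩
        acceptedFlips p 0 0 false P
      ∎
      where
      open ≡-Reasoning
      W = words (n + n)
      lenR : ∀ R → R ∈ flips P → length R ≡ n + n
      lenR R R∈ = trans (sym (Below-length (Flip⇒Below (accepts⇒dyckFrom P (proj₂ (∈F⁻ n P∈F))) (∈⇒Flip P R∈))))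
                        (proj₁ (∈F⁻ n P∈F))

    coverCount≡∑acceptedFlips : ∀ n →
      coverCount p n ≡ ∑[ P ∈ words (n + n) ] (𝟙 (accepts p 0 0 false P) * acceptedFlips p 0 0 false P)
    coverCount≡∑acceptedFlips n = begin
        coverCount p n
      ≡⟨ length≡∑1 (concatMap coversOf (F p n)) ⟩
        ∑[ _ ∈ concatMap coversOf (F p n) ] 1
      ≡⟨ ∑-concatMap coversOf (F p n) _ ⟩
        ∑[ P ∈ F p n ] ∑[ _ ∈ coversOf P ] 1
      ≡⟨ ∑-cong (F p n) (λ P P∈F → trans (∑-filter _ (F p n) _) (trans (∑-filter _ W _)
           (trans (∑-cong W (λ Q _ → cong₂ (λ a b → 𝟙 a * (𝟙 b * 1)) (does-≟true (inF p Q)) (does-≟true (covers p n P Q))))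
                  (coversOf≡acceptedFlips n P P∈F)))) ⟩
        ∑[ P ∈ F p n ] acceptedFlips p 0 0 false P
      ≡⟨ ∑-filter _ W (acceptedFlips p 0 0 false) ⟩
        ∑[ P ∈ W ] (𝟙 (does (inF p P ≟ᵇ true)) * acceptedFlips p 0 0 false P)
      ≡⟨ ∑-cong W (λ P _ → cong (λ b → 𝟙 b * acceptedFlips p 0 0 false P) (trans (does-≟true (inF p P)) (inF≡accepts p P))) ⟩
        ∑[ P ∈ W ] (𝟙 (accepts p 0 0 false P) * acceptedFlips p 0 0 false P)
      ∎
      where
      open ≡-Reasoning
      W = words (n + n)
      coversOf : Word → List Word
      coversOf P = filter (λ Q → covers p n P Q ≟ᵇ true) (F p n)

  -- Compositions with bounded parts

  [1…_] : ℕ → List ℕ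
  [1… q ] = applyDownFrom suc q

  ∈[1…]⁻ : ∀ {r q} → r ∈ [1… q ] → ∃ λ i → r ≡ suc i × suc i ≤ q
  ∈[1…]⁻ r∈ with ∈-applyDownFrom⁻ suc r∈
  ... | i , i<q , refl = i , refl , i<q

  ∈[1…]⇒≤ : ∀ {r q} → r ∈ [1… q ] → 1 ≤ r × r ≤ q
  ∈[1…]⇒≤ r∈ with ∈[1…]⁻ r∈
  ... | i , refl , i<q = s≤s z≤n , i<q

  BoundedParts : ℕ → List ℕ → Set
  BoundedParts p = All (λ r → 1 ≤ r × r ≤ p)

  -- The fuel f ≥ n only serves termination.
  compositionsWithin : ℕ → ℕ → ℕ → List (List ℕ)
  compositionsWithin p f zero = [] ∷ []
  compositionsWithin p zero (suc n) = []
  compositionsWithin p (suc f) (suc n) =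
    concatMap (λ r → if r ≤ᵇ suc n then map (r ∷_) (compositionsWithin p f (suc n ∸ r)) else []) [1… p ]

  compositions : ℕ → ℕ → List (List ℕ)
  compositions p n = compositionsWithin p n n

  concatMap-cong-∈ : ∀ (xs : List A) {f g : A → List B} → (∀ x → x ∈ xs → f x ≡ g x) → concatMap f xs ≡ concatMap g xs
  concatMap-cong-∈ [] f≡g = refl
  concatMap-cong-∈ (x ∷ xs) f≡g = cong₂ _++_ (f≡g x (here refl)) (concatMap-cong-∈ xs (λ y y∈ → f≡g y (there y∈)))

  compositionsWithin-fuel : ∀ p {f f′} n → n ≤ f → n ≤ f′ → compositionsWithin p f n ≡ compositionsWithin p f′ n
  compositionsWithin-fuel p zero _ _ = refl
  compositionsWithin-fuel p {suc f} {suc f′} (suc n) (s≤s n≤f) (s≤s n≤f′) = concatMap-cong-∈ [1… p ] same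
    where
    same : ∀ r → r ∈ [1… p ] → _
    same r r∈ with ∈[1…]⁻ r∈
    ... | i , refl , _ = cong (λ L → if suc i ≤ᵇ suc n then map (suc i ∷_) L else [])
                              (compositionsWithin-fuel p (n ∸ i) (≤-trans (m∸n≤m n i) n≤f) (≤-trans (m∸n≤m n i) n≤f′))

  ∑-if : ∀ b (L : List A) f → ∑ (if b then L else []) f ≡ 𝟙 b * ∑ L f
  ∑-if true L f = sym (+-identityʳ _)
  ∑-if false L f = refl

  ∑-compositionsWithin-suc : ∀ p f n (φ : List ℕ → ℕ) → ∑ (compositionsWithin p (suc f) (suc n)) φ ≡
    ∑[ r ∈ [1… p ] ] (𝟙 (r ≤ᵇ suc n) * ∑[ rs ∈ compositionsWithin p f (suc n ∸ r) ] φ (r ∷ rs))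
  ∑-compositionsWithin-suc p f n φ = trans (∑-concatMap _ [1… p ] φ) (∑-cong [1… p ] λ r _ →
    trans (∑-if (r ≤ᵇ suc n) _ φ) (cong (𝟙 (r ≤ᵇ suc n) *_) (∑-map (r ∷_) (compositionsWithin p f (suc n ∸ r)) φ)))

  ∑-compositions-suc : ∀ p n (φ : List ℕ → ℕ) → ∑ (compositions p (suc n)) φ ≡
    ∑[ r ∈ [1… p ] ] (𝟙 (r ≤ᵇ suc n) * ∑[ rs ∈ compositions p (suc n ∸ r) ] φ (r ∷ rs))
  ∑-compositions-suc p n φ = trans (∑-compositionsWithin-suc p n n φ) (∑-cong [1… p ] fuel)
    where
    fuel : ∀ r → r ∈ [1… p ] → _
    fuel r r∈ with ∈[1…]⁻ r∈
    ... | i , refl , _ = cong (λ L → 𝟙 (suc i ≤ᵇ suc n) * ∑[ rs ∈ L ] φ (suc i ∷ rs))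
                              (compositionsWithin-fuel p (n ∸ i) (m∸n≤m n i) ≤-refl)

  ∈compositions⁻ : ∀ p f n {rs} → rs ∈ compositionsWithin p f n → BoundedParts p rs × sum rs ≡ n
  ∈compositions⁻ p f zero (here refl) = [] , refl
  ∈compositions⁻ p (suc f) (suc n) rs∈ with find (∈-concatMap⁻ _ {xs = [1… p ]} rs∈)
  ... | r , r∈ , rs∈′ with ∈[1…]⁻ r∈
  ... | i , refl , i<p with suc i ≤ᵇ suc n in fits
  ... | true with ∈-map⁻ (suc i ∷_) rs∈′
  ... | rs′ , rs′∈ , refl with ∈compositions⁻ p f (n ∸ i) rs′∈
  ... | bounded , sum≡ =
    ((s≤s z≤n , i<p) ∷ bounded) , cong suc (trans (cong (λ s → i + s) sum≡) (m+[n∸m]≡n (≤-pred (≤ᵇ-true⁻ {suc i} fits))))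

  _≟ₗ_ : DecidableEquality (List ℕ)
  _≟ₗ_ = ≡-dec ℕ._≟_

  ∑-[1…]-below : ∀ q x (g : ℕ → ℕ) → q < x → ∑[ r ∈ [1… q ] ] (𝟙 (does (r ℕ.≟ x)) * g r) ≡ 0
  ∑-[1…]-below zero x g _ = refl
  ∑-[1…]-below (suc q) x g q<x
    rewrite dec-false (suc q ℕ.≟ x) (<⇒≢ q<x) = ∑-[1…]-below q x g (≤-trans (n≤1+n (suc q)) q<x)

  ∑-[1…]-select : ∀ q x (g : ℕ → ℕ) → 1 ≤ x → x ≤ q → ∑[ r ∈ [1… q ] ] (𝟙 (does (r ℕ.≟ x)) * g r) ≡ g x
  ∑-[1…]-select zero x g 1≤x x≤0 = ⊥-elim (<-irrefl refl (≤-trans 1≤x x≤0))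
  ∑-[1…]-select (suc q) x g 1≤x x≤q with m≤n⇒m<n∨m≡n x≤q
  ... | inj₁ x<q rewrite dec-false (suc q ℕ.≟ x) (≢-sym (<⇒≢ x<q)) = ∑-[1…]-select q x g 1≤x (≤-pred x<q)
  ... | inj₂ refl rewrite dec-true (suc q ℕ.≟ suc q) refl | ∑-[1…]-below q (suc q) g ≤-refl = trans (+-identityʳ _) (+-identityʳ _)

  ∑-compositions-≟ : ∀ p f n X → n ≤ f → BoundedParts p X → sum X ≡ n →
    ∑[ rs ∈ compositionsWithin p f n ] 𝟙 (does (rs ≟ₗ X)) ≡ 1
  ∑-compositions-≟ p f zero [] _ _ _ = refl
  ∑-compositions-≟ p f zero (x ∷ X) _ ((1≤x , _) ∷ _) sum≡0 = ⊥-elim (<-irrefl (sym sum≡0) (≤-trans 1≤x (m≤m+n x (sum X))))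
  ∑-compositions-≟ p (suc f) (suc n) (x ∷ X) (s≤s n≤f) ((1≤x , x≤p) ∷ bounded) sum≡ = begin
      ∑ (compositionsWithin p (suc f) (suc n)) (λ rs → 𝟙 (does (rs ≟ₗ (x ∷ X))))
    ≡⟨ ∑-compositionsWithin-suc p f n _ ⟩
      ∑[ r ∈ [1… p ] ] (𝟙 (r ≤ᵇ suc n) * ∑[ rs ∈ compositionsWithin p f (suc n ∸ r) ] 𝟙 (does (r ℕ.≟ x) ∧ does (rs ≟ₗ X)))
    ≡⟨ ∑-cong [1… p ] (λ r _ → factor r) ⟩
      ∑[ r ∈ [1… p ] ] (𝟙 (does (r ℕ.≟ x)) * (𝟙 (r ≤ᵇ suc n) * matches r))
    ≡⟨ ∑-[1…]-select p x _ 1≤x x≤p ⟩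
      𝟙 (x ≤ᵇ suc n) * matches x
    ≡⟨ cong₂ _*_ (cong 𝟙 (≤ᵇ-true x≤n)) (∑-compositions-≟ p f (suc n ∸ x) X (≤-trans (∸-monoʳ-≤ (suc n) 1≤x) n≤f) bounded sumX) ⟩
      1
    ∎
    where
    open ≡-Reasoning
    matches : ℕ → ℕ
    matches r = ∑[ rs ∈ compositionsWithin p f (suc n ∸ r) ] 𝟙 (does (rs ≟ₗ X))
    factor : ∀ r → 𝟙 (r ≤ᵇ suc n) * ∑[ rs ∈ compositionsWithin p f (suc n ∸ r) ] 𝟙 (does (r ℕ.≟ x) ∧ does (rs ≟ₗ X))
                 ≡ 𝟙 (does (r ℕ.≟ x)) * (𝟙 (r ≤ᵇ suc n) * matches r)
    factor r = begin
        𝟙 (r ≤ᵇ suc n) * ∑[ rs ∈ compositionsWithin p f (suc n ∸ r) ] 𝟙 (does (r ℕ.≟ x) ∧ does (rs ≟ₗ X))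
      ≡⟨ cong (𝟙 (r ≤ᵇ suc n) *_) (trans (∑-cong (compositionsWithin p f (suc n ∸ r)) (λ rs _ → 𝟙-∧ (does (r ℕ.≟ x)) (does (rs ≟ₗ X))))
                                         (∑-*ˡ (compositionsWithin p f (suc n ∸ r)) (𝟙 (does (r ℕ.≟ x))) (λ rs → 𝟙 (does (rs ≟ₗ X))))) ⟩
        𝟙 (r ≤ᵇ suc n) * (𝟙 (does (r ℕ.≟ x)) * matches r)
      ≡⟨ *-x∙yz≈y∙xz (𝟙 (r ≤ᵇ suc n)) (𝟙 (does (r ℕ.≟ x))) (matches r) ⟩
        𝟙 (does (r ℕ.≟ x)) * (𝟙 (r ≤ᵇ suc n) * matches r)
      ∎
    x≤n : x ≤ suc n
    x≤n = subst (x ≤_) sum≡ (m≤m+n x (sum X))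
    sumX : sum X ≡ suc n ∸ x
    sumX = sym (trans (cong (_∸ x) (sym sum≡)) (m+n∸m≡n x (sum X)))

  descents : List ℕ → Word
  descents [] = []
  descents (s ∷ ss) = U ∷ (run s ++ descents ss)

  -- U^a D^r U D^s₁ U D^s₂ ⋯, where the initial ascent a = r + ∑ sᵢ − #sᵢ brings the path back to the axis.
  pathOf : List ℕ → Word
  pathOf [] = []
  pathOf (r ∷ rs) = replicate (sum (r ∷ rs) ∸ length rs) U ++ (run r ++ descents rs)

  runLengths : Word → ℕ × List ℕ
  runLengths [] = 0 , []
  runLengths (U ∷ w) = 0 , (proj₁ (runLengths w) ∷ proj₂ (runLengths w))
  runLengths (D ∷ w) = suc (proj₁ (runLengths w)) , proj₂ (runLengths w)

  compositionOf : Word → List ℕ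
  compositionOf [] = []
  compositionOf (U ∷ w) = compositionOf w
  compositionOf (D ∷ w) = suc (proj₁ (runLengths w)) ∷ proj₂ (runLengths w)

  runLengths-descents : ∀ s ss → runLengths (run s ++ descents ss) ≡ (s , ss)
  runLengths-descents zero [] = refl
  runLengths-descents zero (t ∷ ts) rewrite runLengths-descents t ts = refl
  runLengths-descents (suc s) ss rewrite runLengths-descents s ss = refl

  descents-runLengths : ∀ w → run (proj₁ (runLengths w)) ++ descents (proj₂ (runLengths w)) ≡ w
  descents-runLengths [] = refl
  descents-runLengths (U ∷ w) = cong (U ∷_) (descents-runLengths w)
  descents-runLengths (D ∷ w) = cong (D ∷_) (descents-runLengths w)

  compositionOf-Us : ∀ a w → compositionOf (replicate a U ++ w) ≡ compositionOf w
  compositionOf-Us zero w = refl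
  compositionOf-Us (suc a) w = compositionOf-Us a w

  compositionOf-pathOf : ∀ rs → All (1 ≤_) rs → compositionOf (pathOf rs) ≡ rs
  compositionOf-pathOf [] _ = refl
  compositionOf-pathOf (zero ∷ rs) (() ∷ _)
  compositionOf-pathOf (suc r ∷ rs) _
    rewrite compositionOf-Us (sum (suc r ∷ rs) ∸ length rs) (run (suc r) ++ descents rs) | runLengths-descents r rs = refl

  length≤sum : ∀ rs → All (1 ≤_) rs → length rs ≤ sum rs
  length≤sum [] [] = z≤n
  length≤sum (r ∷ rs) (1≤r ∷ pos) = +-mono-≤ 1≤r (length≤sum rs pos)

  positive : ∀ {p rs} → BoundedParts p rs → All (1 ≤_) rs
  positive [] = []
  positive ((1≤r , _) ∷ bounded) = 1≤r ∷ positive bounded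

  length-descents : ∀ ss → length (descents ss) ≡ length ss + sum ss
  length-descents [] = refl
  length-descents (s ∷ ss) rewrite length-++ (run s) {descents ss} | length-replicate s {D} | length-descents ss =
    cong suc (+-x∙yz≈y∙xz s (length ss) (sum ss))

  ascent+length : ∀ r rs → All (1 ≤_) rs → (sum (r ∷ rs) ∸ length rs) + length rs ≡ r + sum rs
  ascent+length r rs pos = m∸n+n≡m (≤-trans (length≤sum rs pos) (m≤n+m (sum rs) r))

  length-pathOf : ∀ rs → All (1 ≤_) rs → length (pathOf rs) ≡ sum rs + sum rs
  length-pathOf [] _ = refl
  length-pathOf (r ∷ rs) (_ ∷ pos) = begin
      length (replicate a U ++ (run r ++ descents rs))
    ≡⟨ trans (length-++ (replicate a U))
             (cong₂ _+_ (length-replicate a) (trans (length-++ (run r)) (cong₂ _+_ (length-replicate r) (length-descents rs)))) ⟩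
      a + (r + (length rs + sum rs))
    ≡⟨ cong (λ m → a + m) (+-x∙yz≈y∙xz r (length rs) (sum rs)) ⟩
      a + (length rs + (r + sum rs))
    ≡⟨ sym (+-assoc a (length rs) (r + sum rs)) ⟩
      a + length rs + (r + sum rs)
    ≡⟨ cong (_+ (r + sum rs)) (ascent+length r rs pos) ⟩
      sum (r ∷ rs) + sum (r ∷ rs)
    ∎
    where
    open ≡-Reasoning
    a = sum (r ∷ rs) ∸ length rs

  accepts-Us : ∀ p a h w → accepts p h 0 false (replicate a U ++ w) ≡ accepts p (a + h) 0 false w
  accepts-Us p zero h w = refl
  accepts-Us p (suc a) h w = trans (accepts-Us p a (suc h) w) (cong (λ z → accepts p z 0 false w) (+-suc a h))

  ∧-implied : ∀ {a} b → (b ≡ true → a ≡ true) → a ∧ b ≡ b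
  ∧-implied {true} b _ = refl
  ∧-implied {false} true b⇒a with b⇒a refl
  ... | ()
  ∧-implied {false} false _ = refl

  all≤ᵇ : ∀ {p ss} → BoundedParts p ss → all (_≤ᵇ p) ss ≡ true
  all≤ᵇ [] = refl
  all≤ᵇ ((_ , t≤p) ∷ bounded) = ∧-true⁺ (≤ᵇ-true t≤p) (all≤ᵇ bounded)

  accepts-descents : ∀ p s ss h d f → 1 ≤ s → All (1 ≤_) ss → h + length ss ≡ s + sum ss →
    accepts p h d f (run s ++ descents ss) ≡ (d + s ≤ᵇ p) ∧ all (_≤ᵇ p) ss
  accepts-descents p (suc s) ss zero d f _ pos balance =
    ⊥-elim (<-irrefl refl (≤-trans (s≤s (≤-trans (length≤sum ss pos) (m≤n+m (sum ss) s))) (≤-reflexive (sym balance))))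
  accepts-descents p (suc (suc s)) ss (suc h) d f _ pos balance
    rewrite accepts-descents p (suc s) ss h (suc d) false (s≤s z≤n) pos (suc-injective balance) | +-suc d (suc s) =
    trans (sym (∧-assoc (d <ᵇ p) _ _))
          (cong (_∧ all (_≤ᵇ p) ss) (∧-implied (suc (d + suc s) ≤ᵇ p)
             (λ fits → <ᵇ-true {n = p} (≤-trans (s≤s (m≤m+n d (suc s))) (≤ᵇ-true⁻ {suc (d + suc s)} fits)))))
  accepts-descents p (suc zero) [] (suc h) d f _ [] balance rewrite +-comm d 1 | +-identityʳ h | suc-injective balance = refl
  accepts-descents p (suc zero) (t ∷ ss) (suc h) d f _ (1≤t ∷ pos) balance
    rewrite accepts-descents p t ss (suc h) 0 true 1≤t pos (suc-injective (trans (sym (+-suc (suc h) (length ss))) balance))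
          | +-comm d 1 = refl

  accepts-pathOf : ∀ p rs → BoundedParts p rs → Accepts p 0 0 false (pathOf rs)
  accepts-pathOf p [] _ = refl
  accepts-pathOf p (r ∷ rs) ((1≤r , r≤p) ∷ bounded) = begin
      accepts p 0 0 false (replicate a U ++ (run r ++ descents rs))
    ≡⟨ accepts-Us p a 0 (run r ++ descents rs) ⟩
      accepts p (a + 0) 0 false (run r ++ descents rs)
    ≡⟨ accepts-descents p r rs (a + 0) 0 false 1≤r (positive bounded)
         (trans (cong (_+ length rs) (+-identityʳ a)) (ascent+length r rs (positive bounded))) ⟩
      (r ≤ᵇ p) ∧ all (_≤ᵇ p) rs
    ≡⟨ ∧-true⁺ (≤ᵇ-true r≤p) (all≤ᵇ bounded) ⟩
      true
    ∎
    where
    open ≡-Reasoning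
    a = sum (r ∷ rs) ∸ length rs

  dyckFrom-balance : ∀ h r rs → dyckFrom h (run r ++ descents rs) ≡ true → h + length rs ≡ r + sum rs
  dyckFrom-balance h zero [] e = trans (+-identityʳ h) (≡ᵇ0⁻ e)
  dyckFrom-balance h zero (s ∷ ss) e = trans (+-suc h (length ss)) (dyckFrom-balance (suc h) s ss e)
  dyckFrom-balance (suc h) (suc r) rs e = cong suc (dyckFrom-balance h r rs e)

  runLengths-accepted : ∀ p T {h d f} → Accepts p h d f (D ∷ T) →
    d + suc (proj₁ (runLengths T)) ≤ p × BoundedParts p (proj₂ (runLengths T))
  runLengths-accepted p [] {suc h} {d} acc = subst (_≤ p) (+-comm 1 d) (<ᵇ-true⁻ (proj₁ (∧-true⁻ {d <ᵇ p} acc))) , []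
  runLengths-accepted p (D ∷ T) {suc h} {d} acc with runLengths-accepted p T {h} {suc d} {false} (proj₂ (∧-true⁻ {d <ᵇ p} acc))
  ... | fits , bounded = subst (_≤ p) (sym (+-suc d (suc (proj₁ (runLengths T))))) fits , bounded
  runLengths-accepted p (U ∷ []) {suc h} {d} acc with proj₂ (∧-true⁻ {d <ᵇ p} acc)
  ... | ()
  runLengths-accepted p (U ∷ U ∷ T) {suc h} {d} acc with proj₂ (∧-true⁻ {d <ᵇ p} acc)
  ... | ()
  runLengths-accepted p (U ∷ D ∷ T) {suc h} {d} acc with runLengths-accepted p T {suc h} {0} {true} (proj₂ (∧-true⁻ {d <ᵇ p} acc))
  ... | fits , bounded = subst (_≤ p) (+-comm 1 d) (<ᵇ-true⁻ (proj₁ (∧-true⁻ {d <ᵇ p} acc))) , ((s≤s z≤n , fits) ∷ bounded)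

  pathOf-compositionOf : ∀ p a w → Accepts p 0 0 false (replicate a U ++ w) →
    BoundedParts p (compositionOf w) × pathOf (compositionOf w) ≡ replicate a U ++ w
  pathOf-compositionOf p zero [] _ = [] , refl
  pathOf-compositionOf p (suc a) [] acc with trans (sym (accepts-Us p (suc a) 0 [])) acc
  ... | ()
  pathOf-compositionOf p a (U ∷ w) acc
    rewrite replicate-++-∷ a U w = pathOf-compositionOf p (suc a) w acc
  pathOf-compositionOf p a (D ∷ T) acc with runLengths-accepted p T {a + 0} {0} {false} accT
    where
    accT : Accepts p (a + 0) 0 false (D ∷ T)
    accT = trans (sym (accepts-Us p a 0 (D ∷ T))) acc
  ... | fits , bounded =
    ((s≤s z≤n , fits) ∷ bounded) , cong₂ (λ m w → replicate m U ++ w) ascent≡a (cong (D ∷_) (descents-runLengths T))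
    where
    r = proj₁ (runLengths T)
    rs = proj₂ (runLengths T)
    balance : a + length rs ≡ suc r + sum rs
    balance = trans (cong (_+ length rs) (sym (+-identityʳ a)))
                (dyckFrom-balance (a + 0) (suc r) rs (subst (λ w → dyckFrom (a + 0) w ≡ true) (sym (cong (D ∷_) (descents-runLengths T)))
                  (accepts⇒dyckFrom {p} {a + 0} {0} {false} (D ∷ T) (trans (sym (accepts-Us p a 0 (D ∷ T))) acc))))
    ascent≡a : suc r + sum rs ∸ length rs ≡ a
    ascent≡a = trans (cong (_∸ length rs) (sym balance)) (m+n∸n≡m a (length rs))

  double-injective : ∀ {m n} → m + m ≡ n + n → m ≡ n
  double-injective {m} {n} e = *-cancelˡ-≡ m n 2 (trans (cong (m +_) (+-identityʳ m)) (trans e (cong (n +_) (sym (+-identityʳ n)))))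

  accepted⇒pathOf : ∀ p n P → Accepts p 0 0 false P → length P ≡ n + n →
    BoundedParts p (compositionOf P) × sum (compositionOf P) ≡ n × pathOf (compositionOf P) ≡ P
  accepted⇒pathOf p n P acc len with pathOf-compositionOf p 0 P acc
  ... | bounded , path≡P =
    bounded , double-injective (trans (sym (length-pathOf _ (positive bounded))) (trans (cong length path≡P) len)) , path≡P

  𝟙-accepts≡∑ : ∀ p n P → length P ≡ n + n → 𝟙 (accepts p 0 0 false P) ≡ ∑[ rs ∈ compositions p n ] 𝟙 (P ==ʷ pathOf rs)
  𝟙-accepts≡∑ p n P len with accepts p 0 0 false P in acc
  ... | false = sym (∑-zero (compositions p n) _ (λ rs rs∈ → cong 𝟙 (≢⇒==ʷ-false P (pathOf rs) (λ { refl →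
                      contradiction (trans (sym (accepts-pathOf p rs (proj₁ (∈compositions⁻ p n n rs∈)))) acc) λ () }))))
  ... | true with accepted⇒pathOf p n P acc len
  ... | bounded , sum≡n , path≡P =
    sym (trans (∑-cong (compositions p n) (λ rs rs∈ → cong 𝟙 (==ʷ-pathOf rs rs∈)))
               (∑-compositions-≟ p n n (compositionOf P) ≤-refl bounded sum≡n))
    where
    ==ʷ-pathOf : ∀ rs → rs ∈ compositions p n → (P ==ʷ pathOf rs) ≡ does (rs ≟ₗ compositionOf P)
    ==ʷ-pathOf rs rs∈ with rs ≟ₗ compositionOf P
    ... | yes refl = subst (λ w → (P ==ʷ w) ≡ true) (sym path≡P) (==ʷ-refl P)
    ... | no rs≢ = ≢⇒==ʷ-false P (pathOf rs)
                     λ { refl → rs≢ (sym (compositionOf-pathOf rs (positive (proj₁ (∈compositions⁻ p n n rs∈))))) }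

  ∑-accepted≡∑-compositions : ∀ p n (φ : Word → ℕ) →
    ∑[ P ∈ words (n + n) ] (𝟙 (accepts p 0 0 false P) * φ P) ≡ ∑[ rs ∈ compositions p n ] φ (pathOf rs)
  ∑-accepted≡∑-compositions p n φ = begin
      ∑[ P ∈ W ] (𝟙 (accepts p 0 0 false P) * φ P)
    ≡⟨ ∑-cong W (λ P P∈ → trans (cong (_* φ P) (𝟙-accepts≡∑ p n P (length-∈-words (n + n) P∈)))
         (trans (*-comm _ (φ P)) (trans (sym (∑-*ˡ (compositions p n) (φ P) _)) (∑-cong (compositions p n) (λ rs _ → *-comm (φ P) _))))) ⟩
      ∑[ P ∈ W ] ∑[ rs ∈ compositions p n ] (𝟙 (P ==ʷ pathOf rs) * φ P)
    ≡⟨ ∑-swap W (compositions p n) _ ⟩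
      ∑[ rs ∈ compositions p n ] ∑[ P ∈ W ] (𝟙 (P ==ʷ pathOf rs) * φ P)
    ≡⟨ ∑-cong (compositions p n) (λ rs rs∈ → ∑-words-==ʷ (n + n) (pathOf rs) (length-of rs rs∈) φ) ⟩
      ∑[ rs ∈ compositions p n ] φ (pathOf rs)
    ∎
    where
    open ≡-Reasoning
    W = words (n + n)
    length-of : ∀ rs → rs ∈ compositions p n → length (pathOf rs) ≡ n + n
    length-of rs rs∈ with ∈compositions⁻ p n n rs∈
    ... | bounded , refl = length-pathOf rs (positive bounded)

  -- The valley between descent runs D^r and D^t can be flipped iff this creates
  -- no D U U (r = 1 right after a D U) and no descent run longer than p.
  flippable : ℕ → Bool → ℕ → ℕ → Bool
  flippable p endsDU r t = (not endsDU ∨ (2 ≤ᵇ r)) ∧ (t <ᵇ p)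

  validFlips : ℕ → Bool → ℕ → List ℕ → ℕ
  validFlips p endsDU r [] = 0
  validFlips p endsDU r (t ∷ ts) = 𝟙 (flippable p endsDU r t) + validFlips p true t ts

  ∑-flips-Us : ∀ a X (φ : Word → ℕ) → ∑ (flips (replicate a U ++ X)) φ ≡ ∑[ R ∈ flips X ] φ (replicate a U ++ R)
  ∑-flips-Us zero X φ = refl
  ∑-flips-Us (suc a) X φ = trans (∑-map (U ∷_) (flips (replicate a U ++ X)) φ) (∑-flips-Us a X (λ R → φ (U ∷ R)))

  flips-run : ∀ r → flips (run r ++ []) ≡ []
  flips-run zero = refl
  flips-run (suc zero) = refl
  flips-run (suc (suc r)) rewrite flips-run (suc r) = refl

  ∑-flips-run-U : ∀ r w (φ : Word → ℕ) →
    ∑ (flips (run (suc r) ++ U ∷ w)) φ ≡ φ (run r ++ U ∷ D ∷ w) + ∑[ R ∈ flips w ] φ (run (suc r) ++ U ∷ R)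
  ∑-flips-run-U zero w φ = cong (φ (U ∷ D ∷ w) +_) (trans (∑-map (D ∷_) (map (U ∷_) (flips w)) φ) (∑-map (U ∷_) (flips w) _))
  ∑-flips-run-U (suc r) w φ = trans (∑-map (D ∷_) (flips (run (suc r) ++ U ∷ w)) φ) (∑-flips-run-U r w (λ R → φ (D ∷ R)))

  accepts-run-U : ∀ p r h d f w → d + suc r ≤ p → accepts p (r + suc h) d f (run (suc r) ++ U ∷ w) ≡ accepts p (suc h) 0 true w
  accepts-run-U p zero h d f w fits rewrite <ᵇ-true {d} {p} (subst (_≤ p) (+-comm d 1) fits) = refl
  accepts-run-U p (suc r) h d f w fits
    rewrite <ᵇ-true {d} {p} (≤-trans (s≤s (m≤m+n d (suc r))) (subst (_≤ p) (+-suc d (suc r)) fits)) =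
    accepts-run-U p r h (suc d) false w (subst (_≤ p) (+-suc d (suc r)) fits)

  accepts-valley-flip : ∀ p r t ss h f → suc r ≤ p → 1 ≤ t → BoundedParts p ss → h + suc (length ss) ≡ suc r + (t + sum ss) →
    accepts p h 0 f (run r ++ U ∷ D ∷ (run t ++ descents ss)) ≡ flippable p f (suc r) t
  accepts-valley-flip p zero t ss h true _ _ _ _ = refl
  accepts-valley-flip p zero t ss h false _ _ bounded balance
    rewrite accepts-descents p (suc t) ss (suc h) 0 false (s≤s z≤n) (positive bounded) (trans (sym (+-suc h (length ss))) balance)
          | all≤ᵇ bounded = ∧-identityʳ _
  accepts-valley-flip p (suc r) t ss h f r<p _ bounded balance
    rewrite accepts-descents p (suc r) (suc t ∷ ss) h 0 f (s≤s z≤n) (s≤s z≤n ∷ positive bounded)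
                             (trans balance (cong suc (sym (+-suc r (t + sum ss)))))
          | all≤ᵇ bounded | ∨-zeroʳ (not f) | ≤ᵇ-true (<⇒≤ r<p) = ∧-identityʳ _

  acceptedFlips-descents : ∀ p rs r h f → 1 ≤ r → r ≤ p → BoundedParts p rs → h + length rs ≡ r + sum rs →
    acceptedFlips p h 0 f (run r ++ descents rs) ≡ validFlips p f r rs
  acceptedFlips-descents p [] r h f _ _ _ _ rewrite flips-run r = refl
  acceptedFlips-descents p (t ∷ ts) (suc r) h f _ r<p ((1≤t , t≤p) ∷ bounded) balance = begin
      acceptedFlips p h 0 f (run (suc r) ++ U ∷ rest)
    ≡⟨ ∑-flips-run-U r rest (λ R → 𝟙 (accepts p h 0 f R)) ⟩
      𝟙 (accepts p h 0 f (run r ++ U ∷ D ∷ rest)) + ∑[ R ∈ flips rest ] 𝟙 (accepts p h 0 f (run (suc r) ++ U ∷ R))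
    ≡⟨ cong₂ _+_ (cong 𝟙 (accepts-valley-flip p r t ts h f r<p 1≤t bounded balance))
                 (∑-cong (flips rest) (λ R _ → cong 𝟙 (trans (cong (λ z → accepts p z 0 f (run (suc r) ++ U ∷ R)) (sym h≡))
                                                            (accepts-run-U p r h′ 0 f R r<p)))) ⟩
      𝟙 (flippable p f (suc r) t) + acceptedFlips p (suc h′) 0 true rest
    ≡⟨ cong (𝟙 (flippable p f (suc r) t) +_) (acceptedFlips-descents p ts t (suc h′) true 1≤t t≤p bounded balance′) ⟩
      validFlips p f (suc r) (t ∷ ts)
    ∎
    where
    open ≡-Reasoning
    rest = run t ++ descents ts
    h′ = h ∸ suc r
    r<h : suc r ≤ h
    r<h = +-cancelʳ-≤ (suc (length ts)) (suc r) h
            (subst (suc r + suc (length ts) ≤_) (sym balance)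
                   (+-monoʳ-≤ (suc r) (+-mono-≤ 1≤t (length≤sum ts (positive bounded)))))
    h≡ : r + suc h′ ≡ h
    h≡ = trans (+-suc r h′) (m+[n∸m]≡n r<h)
    balance′ : suc h′ + length ts ≡ t + sum ts
    balance′ = +-cancelˡ-≡ (suc r) (suc h′ + length ts) (t + sum ts)
      (trans (cong suc (trans (sym (+-assoc r (suc h′) (length ts))) (cong (_+ length ts) h≡)))
             (trans (sym (+-suc h (length ts))) balance))

  validFlipsOf : ℕ → List ℕ → ℕ
  validFlipsOf p [] = 0
  validFlipsOf p (r ∷ rs) = validFlips p false r rs

  acceptedFlips-pathOf : ∀ p rs → BoundedParts p rs → acceptedFlips p 0 0 false (pathOf rs) ≡ validFlipsOf p rs
  acceptedFlips-pathOf p [] _ = refl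
  acceptedFlips-pathOf p (r ∷ rs) ((1≤r , r≤p) ∷ bounded) = begin
      acceptedFlips p 0 0 false (replicate a U ++ (run r ++ descents rs))
    ≡⟨ ∑-flips-Us a (run r ++ descents rs) (λ R → 𝟙 (accepts p 0 0 false R)) ⟩
      ∑[ R ∈ flips (run r ++ descents rs) ] 𝟙 (accepts p 0 0 false (replicate a U ++ R))
    ≡⟨ ∑-cong (flips (run r ++ descents rs)) (λ R _ → cong 𝟙 (accepts-Us p a 0 R)) ⟩
      acceptedFlips p (a + 0) 0 false (run r ++ descents rs)
    ≡⟨ acceptedFlips-descents p rs r (a + 0) false 1≤r r≤p bounded
         (trans (cong (_+ length rs) (+-identityʳ a)) (ascent+length r rs (positive bounded))) ⟩
      validFlips p false r rs
    ∎
    where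
    open ≡-Reasoning
    a = sum (r ∷ rs) ∸ length rs

  -- Recurrences by the first part

  -- ∑_{r = 1}^{q} a (m - r), where terms with r > m are absent
  shiftedSum : ℕ → (ℕ → ℕ) → ℕ → ℕ
  shiftedSum q a m = ∑[ r ∈ [1… q ] ] (𝟙 (r ≤ᵇ m) * a (m ∸ r))

  ∑-[1…]-drop-last : ∀ q (a : ℕ → ℕ) → ∑[ r ∈ [1… suc q ] ] (𝟙 (r <ᵇ suc q) * a r) ≡ ∑[ r ∈ [1… q ] ] a r
  ∑-[1…]-drop-last q a = begin
      𝟙 (q <ᵇ q) * a (suc q) + ∑[ r ∈ [1… q ] ] (𝟙 (r <ᵇ suc q) * a r)
    ≡⟨ cong₂ _+_ (cong (λ b → 𝟙 b * a (suc q)) (≤ᵇ-false {suc q} {q} ≤-refl))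
                 (∑-cong [1… q ] (λ r r∈ → cong (λ b → 𝟙 b * a r) (<ᵇ-true (s≤s (proj₂ (∈[1…]⇒≤ r∈)))))) ⟩
      ∑[ r ∈ [1… q ] ] (1 * a r)
    ≡⟨ ∑-cong [1… q ] (λ r _ → *-identityˡ (a r)) ⟩
      ∑[ r ∈ [1… q ] ] a r
    ∎
    where open ≡-Reasoning

  ∑-[1…]-drop-first : ∀ q (a : ℕ → ℕ) → ∑[ r ∈ [1… suc q ] ] (𝟙 (2 ≤ᵇ r) * a r) + a 1 ≡ ∑[ r ∈ [1… suc q ] ] a r
  ∑-[1…]-drop-first zero a = sym (+-identityʳ (a 1))
  ∑-[1…]-drop-first (suc q) a =
    trans (+-assoc (a (suc (suc q)) + 0) (∑[ r ∈ [1… suc q ] ] (𝟙 (2 ≤ᵇ r) * a r)) (a 1))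
          (cong₂ _+_ (+-identityʳ (a (suc (suc q)))) (∑-[1…]-drop-first q a))

  module Counts (q : ℕ) where

    p = suc q

    firstPartShort : List ℕ → ℕ
    firstPartShort [] = 0
    firstPartShort (t ∷ _) = 𝟙 (t <ᵇ p)

    innerFlips : List ℕ → ℕ
    innerFlips [] = 0
    innerFlips (t ∷ ts) = validFlips p true t ts

    #compositions #firstPartShort #innerFlips #validFlips : ℕ → ℕ
    #compositions n = ∑[ _ ∈ compositions p n ] 1
    #firstPartShort n = ∑ (compositions p n) firstPartShort
    #innerFlips n = ∑ (compositions p n) innerFlips
    #validFlips n = ∑ (compositions p n) (validFlipsOf p)

    validFlipsOf-∷ : ∀ r rs → validFlipsOf p (r ∷ rs) ≡ firstPartShort rs + innerFlips rs
    validFlipsOf-∷ r [] = refl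
    validFlipsOf-∷ r (t ∷ ts) = refl

    innerFlips-∷ : ∀ r rs → innerFlips (r ∷ rs) ≡ 𝟙 (2 ≤ᵇ r) * firstPartShort rs + innerFlips rs
    innerFlips-∷ r [] = sym (trans (+-identityʳ _) (*-zeroʳ (𝟙 (2 ≤ᵇ r))))
    innerFlips-∷ r (t ∷ ts) = cong (_+ innerFlips (t ∷ ts)) (𝟙-∧ (2 ≤ᵇ r) (t <ᵇ p))

    ∑-compositions-suc-by : ∀ n (φ : List ℕ → ℕ) (a : ℕ → ℕ → ℕ) → (∀ r m → ∑[ rs ∈ compositions p m ] φ (r ∷ rs) ≡ a r m) →
      ∑ (compositions p (suc n)) φ ≡ ∑[ r ∈ [1… p ] ] (𝟙 (r ≤ᵇ suc n) * a r (suc n ∸ r))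
    ∑-compositions-suc-by n φ a first =
      trans (∑-compositions-suc p n φ) (∑-cong [1… p ] (λ r _ → cong (𝟙 (r ≤ᵇ suc n) *_) (first r (suc n ∸ r))))

    #compositions-suc : ∀ n → #compositions (suc n) ≡ shiftedSum p #compositions (suc n)
    #compositions-suc n = ∑-compositions-suc-by n (λ _ → 1) (λ _ → #compositions) (λ _ _ → refl)

    #firstPartShort-suc : ∀ n → #firstPartShort (suc n) ≡ shiftedSum q #compositions (suc n)
    #firstPartShort-suc n = begin
        #firstPartShort (suc n)
      ≡⟨ ∑-compositions-suc-by n firstPartShort (λ r m → 𝟙 (r <ᵇ p) * #compositions m)
           (λ r m → trans (∑-cong (compositions p m) (λ _ _ → sym (*-identityʳ _))) (∑-*ˡ (compositions p m) (𝟙 (r <ᵇ p)) (λ _ → 1))) ⟩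
        ∑[ r ∈ [1… p ] ] (𝟙 (r ≤ᵇ suc n) * (𝟙 (r <ᵇ p) * #compositions (suc n ∸ r)))
      ≡⟨ ∑-cong [1… p ] (λ r _ → *-x∙yz≈y∙xz (𝟙 (r ≤ᵇ suc n)) (𝟙 (r <ᵇ p)) _) ⟩
        ∑[ r ∈ [1… p ] ] (𝟙 (r <ᵇ p) * (𝟙 (r ≤ᵇ suc n) * #compositions (suc n ∸ r)))
      ≡⟨ ∑-[1…]-drop-last q (λ r → 𝟙 (r ≤ᵇ suc n) * #compositions (suc n ∸ r)) ⟩
        shiftedSum q #compositions (suc n)
      ∎
      where open ≡-Reasoning

    shiftedSum-+ : ∀ (a b : ℕ → ℕ) m → shiftedSum p (λ k → a k + b k) m ≡ shiftedSum p a m + shiftedSum p b m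
    shiftedSum-+ a b m =
      trans (∑-cong [1… p ] (λ r _ → *-distribˡ-+ (𝟙 (r ≤ᵇ m)) (a (m ∸ r)) (b (m ∸ r))))
            (∑-+ [1… p ] (λ r → 𝟙 (r ≤ᵇ m) * a (m ∸ r)) (λ r → 𝟙 (r ≤ᵇ m) * b (m ∸ r)))

    #innerFlips-suc : ∀ n →
      #innerFlips (suc n) + #firstPartShort n ≡ shiftedSum p #innerFlips (suc n) + shiftedSum p #firstPartShort (suc n)
    #innerFlips-suc n = begin
        #innerFlips m + #firstPartShort n
      ≡⟨ cong (_+ #firstPartShort n) (trans (∑-compositions-suc-by n innerFlips (λ r k → 𝟙 (2 ≤ᵇ r) * #firstPartShort k + #innerFlips k) first)
                                            (trans (∑-cong [1… p ] (λ r _ → rearrange r)) (∑-+ [1… p ] longFirst innerTerm))) ⟩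
        ∑ [1… p ] longFirst + shiftedSum p #innerFlips m + #firstPartShort n
      ≡⟨ shuffle (∑ [1… p ] longFirst) (shiftedSum p #innerFlips m) (#firstPartShort n) ⟩
        ∑ [1… p ] longFirst + (#firstPartShort n + 0) + shiftedSum p #innerFlips m
      ≡⟨ cong (_+ shiftedSum p #innerFlips m) (∑-[1…]-drop-first q (λ r → 𝟙 (r ≤ᵇ m) * #firstPartShort (m ∸ r))) ⟩
        shiftedSum p #firstPartShort m + shiftedSum p #innerFlips m
      ≡⟨ +-comm (shiftedSum p #firstPartShort m) (shiftedSum p #innerFlips m) ⟩
        shiftedSum p #innerFlips m + shiftedSum p #firstPartShort m
      ∎
      where
      open ≡-Reasoning
      m = suc n
      shuffle : ∀ x s k → x + s + k ≡ x + (k + 0) + s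
      shuffle = solve-∀
      longFirst innerTerm : ℕ → ℕ
      longFirst r = 𝟙 (2 ≤ᵇ r) * (𝟙 (r ≤ᵇ m) * #firstPartShort (m ∸ r))
      innerTerm r = 𝟙 (r ≤ᵇ m) * #innerFlips (m ∸ r)
      first : ∀ r k → ∑[ rs ∈ compositions p k ] innerFlips (r ∷ rs) ≡ 𝟙 (2 ≤ᵇ r) * #firstPartShort k + #innerFlips k
      first r k = trans (∑-cong (compositions p k) (λ rs _ → innerFlips-∷ r rs))
                        (trans (∑-+ (compositions p k) _ innerFlips) (cong (_+ #innerFlips k) (∑-*ˡ (compositions p k) (𝟙 (2 ≤ᵇ r)) firstPartShort)))
      rearrange : ∀ r → 𝟙 (r ≤ᵇ m) * (𝟙 (2 ≤ᵇ r) * #firstPartShort (m ∸ r) + #innerFlips (m ∸ r)) ≡ longFirst r + innerTerm r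
      rearrange r = trans (*-distribˡ-+ (𝟙 (r ≤ᵇ m)) _ _) (cong (_+ innerTerm r) (*-x∙yz≈y∙xz (𝟙 (r ≤ᵇ m)) (𝟙 (2 ≤ᵇ r)) _))

    #validFlips-suc : ∀ n → #validFlips (suc n) ≡ shiftedSum p #firstPartShort (suc n) + shiftedSum p #innerFlips (suc n)
    #validFlips-suc n =
      trans (∑-compositions-suc-by n (validFlipsOf p) (λ _ m → #firstPartShort m + #innerFlips m)
               (λ r m → trans (∑-cong (compositions p m) (λ rs _ → validFlipsOf-∷ r rs)) (∑-+ (compositions p m) _ _)))
            (shiftedSum-+ #firstPartShort #innerFlips (suc n))

  coverCount≡#validFlips : ∀ q → 1 ≤ q → ∀ n → coverCount (suc q) n ≡ Counts.#validFlips q n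
  coverCount≡#validFlips q 1≤q n = begin
      coverCount p n
    ≡⟨ CoversInF.coverCount≡∑acceptedFlips (s≤s 1≤q) n ⟩
      ∑[ P ∈ words (n + n) ] (𝟙 (accepts p 0 0 false P) * acceptedFlips p 0 0 false P)
    ≡⟨ ∑-accepted≡∑-compositions p n (acceptedFlips p 0 0 false) ⟩
      ∑[ rs ∈ compositions p n ] acceptedFlips p 0 0 false (pathOf rs)
    ≡⟨ ∑-cong (compositions p n) (λ rs rs∈ → acceptedFlips-pathOf p rs (proj₁ (∈compositions⁻ p n n rs∈))) ⟩
      Counts.#validFlips q n
    ∎
    where
    open ≡-Reasoning
    p = suc q

module PowerSeries where

  open import Data.Nat as ℕ using (ℕ; zero; suc; _∸_)
  import Data.Nat.Properties as ℕₚ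
  open import Data.Integer using (ℤ; +_; 0ℤ; 1ℤ; _+_; _-_; -_; _*_)
  import Data.Integer.Properties as ℤₚ
  open import Data.Integer.Tactic.RingSolver using (solve-∀)
  open import Data.List using ([]; _∷_; map; upTo; applyUpTo)
  open import Data.List.Properties using (map-applyUpTo)
  open import Relation.Binary.PropositionalEquality
  open import Relation.Nullary using (yes; no)
  open import Function using (_∘_)
  open import Data.Empty using (⊥-elim)
  open Combinatorics using (𝟙; shiftedSum; module Counts)

  δ : Series
  δ zero = 1ℤ
  δ (suc n) = 0ℤ

  shift : ℕ → Series → Series
  shift zero f n = f n
  shift (suc k) f zero = 0ℤ
  shift (suc k) f (suc n) = shift k f n

  shift-cong : ∀ k {f g} → f ≗ g → shift k f ≗ shift k g
  shift-cong zero f≗g n = f≗g n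
  shift-cong (suc k) f≗g zero = refl
  shift-cong (suc k) f≗g (suc n) = shift-cong k f≗g n

  shift-zip : ∀ k (F : ℤ → ℤ → ℤ) → F 0ℤ 0ℤ ≡ 0ℤ → ∀ f g n → shift k (λ m → F (f m) (g m)) n ≡ F (shift k f n) (shift k g n)
  shift-zip zero F F00 f g n = refl
  shift-zip (suc k) F F00 f g zero = sym F00
  shift-zip (suc k) F F00 f g (suc n) = shift-zip k F F00 f g n

  shift-add : ∀ k f g n → shift k (λ m → f m + g m) n ≡ shift k f n + shift k g n
  shift-add k = shift-zip k _+_ refl

  shift-sub : ∀ k f g n → shift k (λ m → f m - g m) n ≡ shift k f n - shift k g n
  shift-sub k = shift-zip k _-_ refl

  shift-zero : ∀ k n → shift k (λ _ → 0ℤ) n ≡ 0ℤ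
  shift-zero zero n = refl
  shift-zero (suc k) zero = refl
  shift-zero (suc k) (suc n) = shift-zero k n

  shift-shift : ∀ a b f n → shift a (shift b f) n ≡ shift (a ℕ.+ b) f n
  shift-shift zero b f n = refl
  shift-shift (suc a) b f zero = refl
  shift-shift (suc a) b f (suc n) = shift-shift a b f n

  shift-comm : ∀ a b f n → shift a (shift b f) n ≡ shift b (shift a f) n
  shift-comm a b f n = trans (shift-shift a b f n) (trans (cong (λ k → shift k f n) (ℕₚ.+-comm a b)) (sym (shift-shift b a f n)))

  shiftSum : ℕ → Series → Series
  shiftSum zero f n = 0ℤ
  shiftSum (suc q) f n = shift (suc q) f n + shiftSum q f n

  shiftSum-cong : ∀ q {f g} → f ≗ g → shiftSum q f ≗ shiftSum q g
  shiftSum-cong zero f≗g n = refl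
  shiftSum-cong (suc q) f≗g n = cong₂ _+_ (shift-cong (suc q) f≗g n) (shiftSum-cong q f≗g n)

  shiftSum-at-0 : ∀ q f → shiftSum q f 0 ≡ 0ℤ
  shiftSum-at-0 zero f = refl
  shiftSum-at-0 (suc q) f = trans (ℤₚ.+-identityˡ _) (shiftSum-at-0 q f)

  shiftSum-zero : ∀ q n → shiftSum q (λ _ → 0ℤ) n ≡ 0ℤ
  shiftSum-zero zero n = refl
  shiftSum-zero (suc q) n rewrite shift-zero (suc q) n | shiftSum-zero q n = refl

  shiftSum-add : ∀ q f g n → shiftSum q (λ m → f m + g m) n ≡ shiftSum q f n + shiftSum q g n
  shiftSum-add zero f g n = refl
  shiftSum-add (suc q) f g n rewrite shift-add (suc q) f g n | shiftSum-add q f g n =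
    interchange (shift (suc q) f n) (shift (suc q) g n) (shiftSum q f n) (shiftSum q g n)
    where
    interchange : ∀ a b c d → (a + b) + (c + d) ≡ (a + c) + (b + d)
    interchange = solve-∀

  shiftSum-neg : ∀ q f n → shiftSum q (λ m → - f m) n ≡ - shiftSum q f n
  shiftSum-neg zero f n = refl
  shiftSum-neg (suc q) f n rewrite shiftSum-neg q f n | shift-zip (suc q) (λ x _ → - x) refl f f n =
    sym (ℤₚ.neg-distrib-+ (shift (suc q) f n) (shiftSum q f n))

  shiftSum-sub : ∀ q f g n → shiftSum q (λ m → f m - g m) n ≡ shiftSum q f n - shiftSum q g n
  shiftSum-sub q f g n = trans (shiftSum-add q f (λ m → - g m) n) (cong (λ y → shiftSum q f n + y) (shiftSum-neg q g n))

  shiftSum-shift : ∀ q k f n → shiftSum q (shift k f) n ≡ shift k (shiftSum q f) n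
  shiftSum-shift zero k f n = sym (shift-zero k n)
  shiftSum-shift (suc q) k f n =
    trans (cong₂ _+_ (shift-comm (suc q) k f n) (shiftSum-shift q k f n)) (sym (shift-add k (shift (suc q) f) (shiftSum q f) n))

  shiftSum-comm : ∀ a b f n → shiftSum a (shiftSum b f) n ≡ shiftSum b (shiftSum a f) n
  shiftSum-comm zero b f n = sym (shiftSum-zero b n)
  shiftSum-comm (suc a) b f n =
    trans (cong₂ _+_ (sym (shiftSum-shift b (suc a) f n)) (shiftSum-comm a b f n)) (sym (shiftSum-add b (shift (suc a) f) (shiftSum a f) n))

  shiftSum-telescope : ∀ q f n → shiftSum q f n - shift 1 (shiftSum q f) n ≡ shift 1 f n - shift (suc q) f n
  shiftSum-telescope zero f n rewrite shift-zero 1 n = sym (ℤₚ.+-inverseʳ (shift 1 f n))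
  shiftSum-telescope (suc q) f n rewrite shift-add 1 (shift (suc q) f) (shiftSum q f) n | shift-shift 1 (suc q) f n =
    step (shift (suc q) f n) (shiftSum q f n) (shift (suc (suc q)) f n) (shift 1 (shiftSum q f) n) (shift 1 f n) (shiftSum-telescope q f n)
    where
    step : ∀ a s a′ s′ x → s - s′ ≡ x - a → (a + s) - (a′ + s′) ≡ x - a′
    step a s a′ s′ x eq = trans (shuffle a s a′ s′) (trans (cong (λ y → y + a - a′) eq) (cancel x a a′))
      where
      shuffle : ∀ a s a′ s′ → (a + s) - (a′ + s′) ≡ (s - s′) + a - a′
      shuffle = solve-∀
      cancel : ∀ x a a′ → (x - a) + a - a′ ≡ x - a′
      cancel = solve-∀

  sumℤ-cong : ∀ {A : Set} {F G : A → ℤ} xs → (∀ x → F x ≡ G x) → sumℤ (map F xs) ≡ sumℤ (map G xs)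
  sumℤ-cong [] F≡G = refl
  sumℤ-cong (x ∷ xs) F≡G = cong₂ _+_ (F≡G x) (sumℤ-cong xs F≡G)

  sumℤ-+ : ∀ {A : Set} (F G : A → ℤ) xs → sumℤ (map (λ x → F x + G x) xs) ≡ sumℤ (map F xs) + sumℤ (map G xs)
  sumℤ-+ F G [] = refl
  sumℤ-+ F G (x ∷ xs) rewrite sumℤ-+ F G xs = interchange (F x) (G x) (sumℤ (map F xs)) (sumℤ (map G xs))
    where
    interchange : ∀ a b c d → (a + b) + (c + d) ≡ (a + c) + (b + d)
    interchange = solve-∀

  sumℤ-*ˡ : ∀ {A : Set} (a : ℤ) (F : A → ℤ) xs → sumℤ (map (λ x → a * F x) xs) ≡ a * sumℤ (map F xs)
  sumℤ-*ˡ a F [] = sym (ℤₚ.*-zeroʳ a)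
  sumℤ-*ˡ a F (x ∷ xs) rewrite sumℤ-*ˡ a F xs = sym (ℤₚ.*-distribˡ-+ a (F x) (sumℤ (map F xs)))

  sumℤ-zero : ∀ {A : Set} (F : A → ℤ) xs → (∀ x → F x ≡ 0ℤ) → sumℤ (map F xs) ≡ 0ℤ
  sumℤ-zero F [] _ = refl
  sumℤ-zero F (x ∷ xs) F≡0 rewrite F≡0 x | sumℤ-zero F xs F≡0 = refl

  sumℤ-applyUpTo-suc : ∀ (F : ℕ → ℤ) k → sumℤ (map F (applyUpTo suc k)) ≡ sumℤ (map (F ∘ suc) (upTo k))
  sumℤ-applyUpTo-suc F k = cong sumℤ (trans (map-applyUpTo suc F k) (sym (map-applyUpTo (λ i → i) (F ∘ suc) k)))

  ⊛-congˡ : ∀ {f f′} g n → f ≗ f′ → (f ⊛ g) n ≡ (f′ ⊛ g) n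
  ⊛-congˡ g n f≗f′ = sumℤ-cong (upTo (suc n)) (λ k → cong (_* g (n ∸ k)) (f≗f′ k))

  ⊕-⊛ : ∀ f g h n → ((f ⊕ g) ⊛ h) n ≡ (f ⊛ h) n + (g ⊛ h) n
  ⊕-⊛ f g h n = trans (sumℤ-cong (upTo (suc n)) (λ k → ℤₚ.*-distribʳ-+ (h (n ∸ k)) (f k) (g k)))
                      (sumℤ-+ (λ k → f k * h (n ∸ k)) (λ k → g k * h (n ∸ k)) (upTo (suc n)))

  scale-⊛ : ∀ a f h n → ((λ k → a * f k) ⊛ h) n ≡ a * (f ⊛ h) n
  scale-⊛ a f h n = trans (sumℤ-cong (upTo (suc n)) (λ k → ℤₚ.*-assoc a (f k) (h (n ∸ k))))
                          (sumℤ-*ˡ a (λ k → f k * h (n ∸ k)) (upTo (suc n)))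

  δ-⊛ : ∀ f n → (δ ⊛ f) n ≡ f n
  δ-⊛ f n rewrite sumℤ-applyUpTo-suc (λ k → δ k * f (n ∸ k)) n | sumℤ-zero (λ k → δ (suc k) * f (n ∸ suc k)) (upTo n) (λ _ → refl) =
    trans (ℤₚ.+-identityʳ _) (ℤₚ.*-identityˡ (f n))

  shift1-⊛ : ∀ g f n → (shift 1 g ⊛ f) n ≡ shift 1 (g ⊛ f) n
  shift1-⊛ g f zero = refl
  shift1-⊛ g f (suc m) = trans (ℤₚ.+-identityˡ _) (sumℤ-applyUpTo-suc (λ k → shift 1 g k * f (suc m ∸ k)) (suc m))

  shift-⊛ : ∀ j g f n → (shift j g ⊛ f) n ≡ shift j (g ⊛ f) n
  shift-⊛ zero g f n = refl
  shift-⊛ (suc j) g f n = begin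
      (shift (suc j) g ⊛ f) n
    ≡⟨ ⊛-congˡ f n (λ k → sym (shift-shift 1 j g k)) ⟩
      (shift 1 (shift j g) ⊛ f) n
    ≡⟨ shift1-⊛ (shift j g) f n ⟩
      shift 1 (shift j g ⊛ f) n
    ≡⟨ shift-cong 1 (shift-⊛ j g f) n ⟩
      shift 1 (shift j (g ⊛ f)) n
    ≡⟨ shift-shift 1 j (g ⊛ f) n ⟩
      shift (suc j) (g ⊛ f) n
    ∎
    where open ≡-Reasoning

  shift-δ-same : ∀ n → shift n δ n ≡ 1ℤ
  shift-δ-same zero = refl
  shift-δ-same (suc n) = shift-δ-same n

  shift-δ-other : ∀ k n → n ≢ k → shift k δ n ≡ 0ℤ
  shift-δ-other zero zero n≢k = ⊥-elim (n≢k refl)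
  shift-δ-other zero (suc n) _ = refl
  shift-δ-other (suc k) zero _ = refl
  shift-δ-other (suc k) (suc n) n≢k = shift-δ-other k n (n≢k ∘ cong suc)

  mono≡shift-δ : ∀ a k n → mono a k n ≡ a * shift k δ n
  mono≡shift-δ a k n with n ℕ.≟ k
  ... | yes refl = sym (trans (cong (a *_) (shift-δ-same n)) (ℤₚ.*-identityʳ a))
  ... | no n≢k = sym (trans (cong (a *_) (shift-δ-other k n n≢k)) (ℤₚ.*-zeroʳ a))

  mono-⊛ : ∀ a k f n → (mono a k ⊛ f) n ≡ a * shift k f n
  mono-⊛ a k f n = begin
      (mono a k ⊛ f) n
    ≡⟨ ⊛-congˡ f n (mono≡shift-δ a k) ⟩
      ((λ i → a * shift k δ i) ⊛ f) n
    ≡⟨ scale-⊛ a (shift k δ) f n ⟩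
      a * (shift k δ ⊛ f) n
    ≡⟨ cong (a *_) (trans (shift-⊛ k δ f n) (shift-cong k (δ-⊛ f) n)) ⟩
      a * shift k f n
    ∎
    where open ≡-Reasoning

  binomial-⊛ : ∀ a i b j f n → ((mono a i ⊕ mono b j) ⊛ f) n ≡ a * shift i f n + b * shift j f n
  binomial-⊛ a i b j f n = trans (⊕-⊛ (mono a i) (mono b j) f n) (cong₂ _+_ (mono-⊛ a i f n) (mono-⊛ b j f n))

  shift-lin : ∀ k a b f g n → shift k (λ m → a * f m + b * g m) n ≡ a * shift k f n + b * shift k g n
  shift-lin k a b = shift-zip k (λ x y → a * x + b * y) (vanish a b)
    where
    vanish : ∀ a b → a * 0ℤ + b * 0ℤ ≡ 0ℤ
    vanish = solve-∀

  byDen : ℕ → Series → Series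
  byDen p f n = + 1 * shift 0 f n + (- (+ 2) * shift 1 f n + + 1 * shift (suc p) f n)

  den-⊛ : ∀ p f n → (den p ⊛ f) n ≡ byDen p f n
  den-⊛ p f n = trans (⊕-⊛ (mono (+ 1) 0) (mono (- (+ 2)) 1 ⊕ mono (+ 1) (suc p)) f n)
                      (cong₂ _+_ (mono-⊛ (+ 1) 0 f n) (binomial-⊛ (- (+ 2)) 1 (+ 1) (suc p) f n))

  byDen-cong : ∀ p {f g} → f ≗ g → byDen p f ≗ byDen p g
  byDen-cong p f≗g n = cong₂ (λ a b → + 1 * a + b) (f≗g n)
                         (cong₂ (λ a b → - (+ 2) * a + + 1 * b) (shift-cong 1 f≗g n) (shift-cong (suc p) f≗g n))

  byDen-⊛ : ∀ p g f n → (byDen p g ⊛ f) n ≡ byDen p (g ⊛ f) n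
  byDen-⊛ p g f n = begin
      ((g₀ ⊕ (g₁ ⊕ g₂)) ⊛ f) n
    ≡⟨ trans (⊕-⊛ g₀ (g₁ ⊕ g₂) f n) (cong (λ x → (g₀ ⊛ f) n + x) (⊕-⊛ g₁ g₂ f n)) ⟩
      (g₀ ⊛ f) n + ((g₁ ⊛ f) n + (g₂ ⊛ f) n)
    ≡⟨ cong₂ (λ a b → a + b) (scale-⊛ (+ 1) (shift 0 g) f n)
         (cong₂ _+_ (scale-⊛ (- (+ 2)) (shift 1 g) f n) (scale-⊛ (+ 1) (shift (suc p) g) f n)) ⟩
      + 1 * (shift 0 g ⊛ f) n + (- (+ 2) * (shift 1 g ⊛ f) n + + 1 * (shift (suc p) g ⊛ f) n)
    ≡⟨ cong₂ (λ a b → + 1 * a + b) (shift-⊛ 0 g f n)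
         (cong₂ (λ a b → - (+ 2) * a + + 1 * b) (shift-⊛ 1 g f n) (shift-⊛ (suc p) g f n)) ⟩
      byDen p (g ⊛ f) n
    ∎
    where
    open ≡-Reasoning
    g₀ g₁ g₂ : Series
    g₀ k = + 1 * shift 0 g k
    g₁ k = - (+ 2) * shift 1 g k
    g₂ k = + 1 * shift (suc p) g k

  den²-⊛ : ∀ p f n → ((den p ⊛ den p) ⊛ f) n ≡ byDen p (byDen p f) n
  den²-⊛ p f n = trans (⊛-congˡ f n (den-⊛ p (den p))) (trans (byDen-⊛ p (den p) f n) (byDen-cong p (den-⊛ p f) n))

  byDen-sub : ∀ p f g n → byDen p (λ m → f m - g m) n ≡ byDen p f n - byDen p g n
  byDen-sub p f g n rewrite shift-sub 1 f g n | shift-sub (suc p) f g n =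
    linear (f n) (g n) (shift 1 f n) (shift 1 g n) (shift (suc p) f n) (shift (suc p) g n)
    where
    linear : ∀ a b c d e h → + 1 * (a - b) + (- (+ 2) * (c - d) + + 1 * (e - h))
                           ≡ (+ 1 * a + (- (+ 2) * c + + 1 * e)) - (+ 1 * b + (- (+ 2) * d + + 1 * h))
    linear = solve-∀

  byDen-shift : ∀ p k f n → byDen p (shift k f) n ≡ shift k (byDen p f) n
  byDen-shift p k f n = begin
      byDen p (shift k f) n
    ≡⟨ cong₂ (λ a b → + 1 * shift k f n + (- (+ 2) * a + + 1 * b)) (shift-comm 1 k f n) (shift-comm (suc p) k f n) ⟩
      + 1 * shift k f n + (- (+ 2) * shift k (shift 1 f) n + + 1 * shift k (shift (suc p) f) n)
    ≡⟨ cong (λ y → + 1 * shift k f n + y) (sym (shift-lin k (- (+ 2)) (+ 1) (shift 1 f) (shift (suc p) f) n)) ⟩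
      + 1 * shift k f n + shift k tail n
    ≡⟨ sym (shift-zip k (λ x y → + 1 * x + y) (vanish (+ 1)) f tail n) ⟩
      shift k (byDen p f) n
    ∎
    where
    open ≡-Reasoning
    tail : Series
    tail m = - (+ 2) * shift 1 f m + + 1 * shift (suc p) f m
    vanish : ∀ a → a * 0ℤ + 0ℤ ≡ 0ℤ
    vanish = solve-∀

  oneMinusX : Series → Series
  oneMinusX f n = f n - shift 1 f n

  oneMinusS : ℕ → Series → Series
  oneMinusS p f n = f n - shiftSum p f n

  byDen≡oneMinusX∘oneMinusS : ∀ p f n → byDen p f n ≡ oneMinusX (oneMinusS p f) n
  byDen≡oneMinusX∘oneMinusS p f n rewrite shift-sub 1 f (shiftSum p f) n =
    regroup (f n) (shift 1 f n) (shiftSum p f n) (shift 1 (shiftSum p f) n) (shift (suc p) f n) (shiftSum-telescope p f n)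
    where
    regroup : ∀ a b s t e → s - t ≡ b - e → + 1 * a + (- (+ 2) * b + + 1 * e) ≡ (a - s) - (b - t)
    regroup a b s t e s-t≡b-e = trans (expand a b e) (trans (cong (λ z → a - b - z) (sym s-t≡b-e)) (swap a b s t))
      where
      expand : ∀ a b e → + 1 * a + (- (+ 2) * b + + 1 * e) ≡ a - b - (b - e)
      expand = solve-∀
      swap : ∀ a b s t → a - b - (s - t) ≡ (a - s) - (b - t)
      swap = solve-∀

  toℤ : (ℕ → ℕ) → Series
  toℤ a n = + a n

  shift-toℤ : ∀ k (a : ℕ → ℕ) m → + (𝟙 (k ℕ.≤ᵇ m) ℕ.* a (m ∸ k)) ≡ shift k (toℤ a) m
  shift-toℤ zero a m = cong +_ (ℕₚ.+-identityʳ (a m))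
  shift-toℤ (suc k) a zero = refl
  shift-toℤ (suc zero) a (suc m) = shift-toℤ zero a m
  shift-toℤ (suc (suc k)) a (suc m) = shift-toℤ (suc k) a m

  shiftedSum≡shiftSum : ∀ q a m → + shiftedSum q a m ≡ shiftSum q (toℤ a) m
  shiftedSum≡shiftSum zero a m = refl
  shiftedSum≡shiftSum (suc q) a m = cong₂ _+_ (shift-toℤ (suc q) a m) (shiftedSum≡shiftSum q a m)

  -- With S = x + ⋯ + x^p: G = 1 + S G, K = (S - x^p) G, B = S B + (S - x) K and C = S (K + B).
  module Recurrences (q : ℕ) where
    open Counts q

    G K B C : Series
    G = toℤ #compositions
    K = toℤ #firstPartShort
    B = toℤ #innerFlips
    C = toℤ #validFlips

    G-rec : ∀ n → G n ≡ δ n + shiftSum p G n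
    G-rec zero = cong (λ x → 1ℤ + x) (sym (shiftSum-at-0 p G))
    G-rec (suc n) = trans (cong +_ (#compositions-suc n)) (trans (shiftedSum≡shiftSum p #compositions (suc n)) (sym (ℤₚ.+-identityˡ _)))

    K-rec : ∀ n → K n ≡ shiftSum q G n
    K-rec zero = sym (shiftSum-at-0 q G)
    K-rec (suc n) = trans (cong +_ (#firstPartShort-suc n)) (shiftedSum≡shiftSum q #compositions (suc n))

    B-rec : ∀ n → B n ≡ shiftSum p B n + (shiftSum p K n - shift 1 K n)
    B-rec zero rewrite shiftSum-at-0 p B | shiftSum-at-0 p K = refl
    B-rec (suc n) = begin
        + #innerFlips (suc n)
      ≡⟨ solve (+ #innerFlips (suc n)) (K n) ⟩
        + #innerFlips (suc n) + K n - K n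
      ≡⟨ cong (_- K n) (cong +_ (#innerFlips-suc n)) ⟩
        + (shiftedSum p #innerFlips (suc n) ℕ.+ shiftedSum p #firstPartShort (suc n)) - K n
      ≡⟨ cong (_- K n) (cong₂ _+_ (shiftedSum≡shiftSum p #innerFlips (suc n)) (shiftedSum≡shiftSum p #firstPartShort (suc n))) ⟩
        shiftSum p B (suc n) + shiftSum p K (suc n) - K n
      ≡⟨ ℤₚ.+-assoc (shiftSum p B (suc n)) (shiftSum p K (suc n)) (- K n) ⟩
        shiftSum p B (suc n) + (shiftSum p K (suc n) - shift 1 K (suc n))
      ∎
      where
      open ≡-Reasoning
      solve : ∀ x y → x ≡ x + y - y
      solve = solve-∀

    C-rec : ∀ n → C n ≡ shiftSum p K n + shiftSum p B n
    C-rec zero rewrite shiftSum-at-0 p B | shiftSum-at-0 p K = refl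
    C-rec (suc n) = trans (cong +_ (#validFlips-suc n))
                          (cong₂ _+_ (shiftedSum≡shiftSum p #firstPartShort (suc n)) (shiftedSum≡shiftSum p #innerFlips (suc n)))

  module Computation (q : ℕ) where
    open Counts q using (p)
    open Recurrences q

    oneMinusS-G : ∀ n → oneMinusS p G n ≡ δ n
    oneMinusS-G n = trans (cong (_- shiftSum p G n) (G-rec n)) (cancel (δ n) (shiftSum p G n))
      where
      cancel : ∀ a b → a + b - b ≡ a
      cancel = solve-∀

    -- (1 - x) K, since K = (x + ⋯ + x^{p-1}) G
    Z : Series
    Z n = shift 1 G n - shift p G n

    oneMinusS-K : ∀ m → oneMinusS p K m ≡ shiftSum q δ m
    oneMinusS-K m = trans (cong₂ _-_ (K-rec m) (trans (shiftSum-cong p K-rec m) (shiftSum-comm p q G m)))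
                          (trans (sym (shiftSum-sub q G (shiftSum p G) m)) (shiftSum-cong q oneMinusS-G m))

    oneMinusS-B : ∀ m → oneMinusS p B m ≡ shiftSum p K m - shift 1 K m
    oneMinusS-B m = trans (cong (_- shiftSum p B m) (B-rec m)) (cancel (shiftSum p B m) _)
      where
      cancel : ∀ a b → a + b - a ≡ b
      cancel = solve-∀

    oneMinusS-K+B : ∀ m → oneMinusS p K m + oneMinusS p B m ≡ Z m
    oneMinusS-K+B m = begin
        oneMinusS p K m + oneMinusS p B m
      ≡⟨ cong₂ _+_ (oneMinusS-K m) (oneMinusS-B m) ⟩
        shiftSum q δ m + (shiftSum p K m - shift 1 K m)
      ≡⟨ cong₂ (λ a b → shiftSum q δ m + (a - b))
           (trans (shiftSum-cong p K-rec m) (shiftSum-comm p q G m))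
           (trans (shift-cong 1 K-rec m) (sym (shiftSum-shift q 1 G m))) ⟩
        shiftSum q δ m + (shiftSum q (shiftSum p G) m - shiftSum q (shift 1 G) m)
      ≡⟨ sym (trans (shiftSum-add q δ (λ k → shiftSum p G k - shift 1 G k) m)
                    (cong (λ x → shiftSum q δ m + x) (shiftSum-sub q (shiftSum p G) (shift 1 G) m))) ⟩
        shiftSum q (λ k → δ k + (shiftSum p G k - shift 1 G k)) m
      ≡⟨ shiftSum-cong q (λ k → trans (assoc (δ k) (shiftSum p G k) (shift 1 G k)) (cong (_- shift 1 G k) (sym (G-rec k)))) m ⟩
        shiftSum q (λ k → G k - shift 1 G k) m
      ≡⟨ trans (shiftSum-sub q G (shift 1 G) m) (cong (λ x → shiftSum q G m - x) (shiftSum-shift q 1 G m)) ⟩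
        shiftSum q G m - shift 1 (shiftSum q G) m
      ≡⟨ shiftSum-telescope q G m ⟩
        Z m
      ∎
      where
      open ≡-Reasoning
      assoc : ∀ a b c → a + (b - c) ≡ a + b - c
      assoc = solve-∀

    oneMinusS-C : ∀ n → oneMinusS p C n ≡ shiftSum p Z n
    oneMinusS-C n = begin
        C n - shiftSum p C n
      ≡⟨ cong₂ _-_ (C-rec n) (trans (shiftSum-cong p C-rec n) (shiftSum-add p SK SB n)) ⟩
        (SK n + SB n) - (shiftSum p SK n + shiftSum p SB n)
      ≡⟨ regroup (SK n) (SB n) (shiftSum p SK n) (shiftSum p SB n) ⟩
        (SK n - shiftSum p SK n) + (SB n - shiftSum p SB n)
      ≡⟨ sym (cong₂ _+_ (shiftSum-sub p K SK n) (shiftSum-sub p B SB n)) ⟩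
        shiftSum p (oneMinusS p K) n + shiftSum p (oneMinusS p B) n
      ≡⟨ sym (shiftSum-add p (oneMinusS p K) (oneMinusS p B) n) ⟩
        shiftSum p (λ m → oneMinusS p K m + oneMinusS p B m) n
      ≡⟨ shiftSum-cong p oneMinusS-K+B n ⟩
        shiftSum p Z n
      ∎
      where
      open ≡-Reasoning
      SK SB : Series
      SK = shiftSum p K
      SB = shiftSum p B
      regroup : ∀ a b c d → (a + b) - (c + d) ≡ (a - c) + (b - d)
      regroup = solve-∀

    byDen-C : ∀ n → byDen p C n ≡ shift 1 Z n - shift (suc p) Z n
    byDen-C n = trans (byDen≡oneMinusX∘oneMinusS p C n)
                      (trans (cong₂ _-_ (oneMinusS-C n) (shift-cong 1 oneMinusS-C n)) (shiftSum-telescope p Z n))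

    byDen-G : ∀ n → byDen p G n ≡ oneMinusX δ n
    byDen-G n = trans (byDen≡oneMinusX∘oneMinusS p G n) (cong₂ _-_ (oneMinusS-G n) (shift-cong 1 oneMinusS-G n))

    W : Series
    W m = shift 1 (oneMinusX δ) m - shift p (oneMinusX δ) m

    byDen²-C : ∀ n → byDen p (byDen p C) n ≡ shift 1 W n - shift (suc p) W n
    byDen²-C n = begin
        byDen p (byDen p C) n
      ≡⟨ byDen-cong p byDen-C n ⟩
        byDen p (λ m → shift 1 Z m - shift (suc p) Z m) n
      ≡⟨ byDen-sub p (shift 1 Z) (shift (suc p) Z) n ⟩
        byDen p (shift 1 Z) n - byDen p (shift (suc p) Z) n
      ≡⟨ cong₂ _-_ (byDen-shift p 1 Z n) (byDen-shift p (suc p) Z n) ⟩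
        shift 1 (byDen p Z) n - shift (suc p) (byDen p Z) n
      ≡⟨ cong₂ _-_ (shift-cong 1 byDen-Z n) (shift-cong (suc p) byDen-Z n) ⟩
        shift 1 W n - shift (suc p) W n
      ∎
      where
      open ≡-Reasoning
      byDen-Z : ∀ m → byDen p Z m ≡ W m
      byDen-Z m = trans (byDen-sub p (shift 1 G) (shift p G) m)
                    (trans (cong₂ _-_ (byDen-shift p 1 G m) (byDen-shift p p G m))
                           (cong₂ _-_ (shift-cong 1 byDen-G m) (shift-cong p byDen-G m)))

    module _ (n : ℕ) where

      d : ℕ → ℤ
      d e = shift e δ n

      1-x^p : Series
      1-x^p = mono (+ 1) 0 ⊕ mono (- (+ 1)) p

      x²-x^p+1 : Series
      x²-x^p+1 = mono (+ 1) 2 ⊕ mono (- (+ 1)) (suc p)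

      shift-1-x^p : ∀ i → shift i 1-x^p n ≡ + 1 * d i + - (+ 1) * d (i ℕ.+ p)
      shift-1-x^p i = trans (shift-cong i (λ k → cong₂ _+_ (mono≡shift-δ (+ 1) 0 k) (mono≡shift-δ (- (+ 1)) p k)) n)
                            (trans (shift-lin i (+ 1) (- (+ 1)) δ (shift p δ) n)
                                   (cong (λ x → + 1 * d i + - (+ 1) * x) (shift-shift i p δ n)))

      shift-product : ∀ j → shift j (x²-x^p+1 ⊛ 1-x^p) n ≡ + 1 * shift (j ℕ.+ 2) 1-x^p n + - (+ 1) * shift (j ℕ.+ suc p) 1-x^p n
      shift-product j = trans (shift-cong j (binomial-⊛ (+ 1) 2 (- (+ 1)) (suc p) 1-x^p) n)
                          (trans (shift-lin j (+ 1) (- (+ 1)) (shift 2 1-x^p) (shift (suc p) 1-x^p) n)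
                                 (cong₂ (λ a b → + 1 * a + - (+ 1) * b) (shift-shift j 2 1-x^p n) (shift-shift j (suc p) 1-x^p n)))

      shift-oneMinusX-δ : ∀ i → shift i (oneMinusX δ) n ≡ d i - d (suc i)
      shift-oneMinusX-δ i = trans (shift-sub i δ (shift 1 δ) n) (cong (λ x → d i - x) (trans (shift-comm i 1 δ n) (shift-shift 1 i δ n)))

      shift-1-W : shift 1 W n ≡ shift 2 (oneMinusX δ) n - shift (suc p) (oneMinusX δ) n
      shift-1-W = trans (shift-sub 1 (shift 1 (oneMinusX δ)) (shift p (oneMinusX δ)) n)
                        (cong₂ _-_ (shift-shift 1 1 (oneMinusX δ) n) (shift-shift 1 p (oneMinusX δ) n))

      shift-p+1-W : shift (suc p) W n ≡ shift (suc (suc p)) (oneMinusX δ) n - shift (suc p ℕ.+ p) (oneMinusX δ) n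
      shift-p+1-W = trans (shift-sub (suc p) (shift 1 (oneMinusX δ)) (shift p (oneMinusX δ)) n)
                          (cong₂ _-_ (trans (shift-comm (suc p) 1 (oneMinusX δ) n) (shift-shift 1 (suc p) (oneMinusX δ) n))
                                     (shift-shift (suc p) p (oneMinusX δ) n))

      num≡ : num p n ≡ shift 1 W n - shift (suc p) W n
      num≡ = begin
          num p n
        ≡⟨ binomial-⊛ (+ 1) 0 (- (+ 1)) 1 (x²-x^p+1 ⊛ 1-x^p) n ⟩
          + 1 * shift 0 (x²-x^p+1 ⊛ 1-x^p) n + - (+ 1) * shift 1 (x²-x^p+1 ⊛ 1-x^p) n
        ≡⟨ cong₂ (λ a b → + 1 * a + - (+ 1) * b) (shift-product 0) (shift-product 1) ⟩
          + 1 * (+ 1 * shift 2 1-x^p n + - (+ 1) * shift (suc p) 1-x^p n) + - (+ 1) * (+ 1 * shift 3 1-x^p n + - (+ 1) * shift (suc (suc p)) 1-x^p n)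
        ≡⟨ cong₂ (λ a b → + 1 * a + - (+ 1) * b)
             (cong₂ (λ x y → + 1 * x + - (+ 1) * y) (shift-1-x^p 2) (shift-1-x^p (suc p)))
             (cong₂ (λ x y → + 1 * x + - (+ 1) * y) (shift-1-x^p 3) (shift-1-x^p (suc (suc p)))) ⟩
          + 1 * (+ 1 * (+ 1 * d 2 + - (+ 1) * d (2 ℕ.+ p)) + - (+ 1) * (+ 1 * d (suc p) + - (+ 1) * d (suc p ℕ.+ p)))
            + - (+ 1) * (+ 1 * (+ 1 * d 3 + - (+ 1) * d (3 ℕ.+ p)) + - (+ 1) * (+ 1 * d (suc (suc p)) + - (+ 1) * d (suc (suc p) ℕ.+ p)))
        ≡⟨ expand (d 2) (d 3) (d (suc p)) (d (suc (suc p))) (d (suc (suc (suc p)))) (d (suc (p ℕ.+ p))) (d (suc (suc (p ℕ.+ p)))) ⟩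
          ((d 2 - d 3) - (d (suc p) - d (suc (suc p)))) - ((d (suc (suc p)) - d (suc (suc (suc p)))) - (d (suc (p ℕ.+ p)) - d (suc (suc (p ℕ.+ p)))))
        ≡⟨ sym (cong₂ _-_ (trans shift-1-W (cong₂ _-_ (shift-oneMinusX-δ 2) (shift-oneMinusX-δ (suc p))))
                          (trans shift-p+1-W (cong₂ _-_ (shift-oneMinusX-δ (suc (suc p))) (shift-oneMinusX-δ (suc p ℕ.+ p))))) ⟩
          shift 1 W n - shift (suc p) W n
        ∎
        where
        open ≡-Reasoning
        expand : ∀ a b c e f g h → + 1 * (+ 1 * (+ 1 * a + - (+ 1) * e) + - (+ 1) * (+ 1 * c + - (+ 1) * g))
                                      + - (+ 1) * (+ 1 * (+ 1 * b + - (+ 1) * f) + - (+ 1) * (+ 1 * e + - (+ 1) * h))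
                                 ≡ ((a - b) - (c - e)) - ((e - f) - (g - h))
        expand = solve-∀

open import Data.Nat using (ℕ; suc; _≤_; s≤s)
open import Data.Integer using (+_; _-_)
open import Relation.Binary.PropositionalEquality using (_≡_; cong; sym; module ≡-Reasoning)
open Combinatorics using (coverCount≡#validFlips)
open PowerSeries using (den²-⊛; byDen; byDen-cong; shift; module Recurrences; module Computation)

corollary2p2 : (p : ℕ) → 2 ≤ p →
    (n : ℕ) → ((den p ⊛ den p) ⊛ cSeries p) n ≡ num p n
corollary2p2 (suc q) (s≤s 1≤q) n = begin
    ((den p ⊛ den p) ⊛ cSeries p) n
  ≡⟨ den²-⊛ p (cSeries p) n ⟩
    byDen p (byDen p (cSeries p)) n
  ≡⟨ byDen-cong p (byDen-cong p (λ k → cong +_ (coverCount≡#validFlips q 1≤q k))) n ⟩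
    byDen p (byDen p C) n
  ≡⟨ byDen²-C n ⟩
    shift 1 W n - shift (suc p) W n
  ≡⟨ sym (num≡ n) ⟩
    num p n
  ∎
  where
  open ≡-Reasoning
  p = suc q
  open Recurrences q using (C)
  open Computation q using (byDen²-C; W; num≡)
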